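{- Let $n>0$. Then the poset $(\mathcal{W}(S_n),\leqslant_R)$ is isomorphic to the product poset $(S_{\lceil n/2\rceil},\leqslant_R)\times\mathcal{P}([\lfloor n/2\rfloor])$, where $\mathcal{P}([\lfloor n/2\rfloor])$ is ordered by inclusion. In particular, $(\mathcal{W}(S_n),\leqslant_R)$ is a complemented lattice.
   Context: $S_k$ is the symmetric group on $[k]$ with simple generators the adjacent transpositions $s_i=(i,i+1)$ and length $\ell$ = number of inversions. The right weak order $\leqslant_R$ on $S_k$ is the partial order generated by the covers $u\vartriangleleft_R us_i$ whenever $\ell(us_i)=\ell(u)+1$. For $i\in[n]$ let $i^*=i-1$ if $i$ even, $i^*=i+1$ if $i$ odd and $i+1\le n$, $i^*=n$ otherwise. The Wachs permutations are $\mathcal{W}(S_n)=\{\sigma\in S_n: |\sigma^{ -1}(i)-\sigma^{ -1}(i^*)|\le1\ \forall i\in[n-1]\}$, ordered by the restriction of $\leqslant_R$ on $S_n$. -}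

module Defs where

open import Data.Nat as ℕ using (ℕ; zero; suc; _∸_; _≤_; _<_; ∣_-_∣; ⌈_/2⌉; ⌊_/2⌋)
open import Data.Nat.Properties using (≤-pred; m<n⇒m<1+n)
open import Data.Bool using (Bool; true; false; if_then_else_)
open import Data.Fin as Fin using (Fin; toℕ; fromℕ<)
open import Data.Fin.Permutation using (Permutation′; _⟨$⟩ʳ_; _⟨$⟩ˡ_; _∘ₚ_; transpose; _≈_)
open import Data.Fin.Subset using (Subset; _⊆_)
open import Data.List using (List; length; filter; cartesianProduct; allFin)
open import Data.Product using (Σ; ∃; _×_; _,_; proj₁; proj₂)
open import Relation.Nullary using (¬_)
open import Relation.Nullary.Decidable using (_×-dec_)
open import Relation.Binary.PropositionalEquality using (_≡_)
open import Relation.Binary.Construct.Closure.ReflexiveTransitive using (Star)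

-- S_n : permutations of Fin n (0-indexed positions/values), in one-line
-- notation: σ ⟨$⟩ʳ j is the value at position j, σ ⟨$⟩ˡ i is σ⁻¹(i).
Perm : ℕ → Set
Perm = Permutation′

inversions : ∀ {n} → Perm n → List (Fin n × Fin n)
inversions {n} σ =
  filter (λ p → (proj₁ p Fin.<? proj₂ p) ×-dec ((σ ⟨$⟩ʳ proj₂ p) Fin.<? (σ ⟨$⟩ʳ proj₁ p)))
         (cartesianProduct (allFin n) (allFin n))

ℓ : ∀ {n} → Perm n → ℕ
ℓ σ = length (inversions σ)

-- simple generator s_i = (i, i+1), i ∈ [n-1]; here 0-indexed: swaps positions i and i+1
s : ∀ {n} (i : ℕ) → suc i < n → Perm n
s i p = transpose (fromℕ< (≤-pred (m<n⇒m<1+n p))) (fromℕ< p)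

-- u s_i : (u s_i)(j) = u(s_i(j))   (apply s_i first, then u)
_·s[_,_] : ∀ {n} → Perm n → (i : ℕ) → suc i < n → Perm n
u ·s[ i , p ] = s i p ∘ₚ u

_⋖R_ : ∀ {n} → Perm n → Perm n → Set
_⋖R_ {n} u v = Σ ℕ λ i → Σ (suc i < n) λ p → (v ≈ (u ·s[ i , p ])) × (ℓ v ≡ suc (ℓ u))

_≤R_ : ∀ {n} → Perm n → Perm n → Set
u ≤R v = Σ _ λ w → Star _⋖R_ u w × (w ≈ v)

isEven : ℕ → Bool
isEven zero = true
isEven (suc zero) = false
isEven (suc (suc i)) = isEven i

-- i* for i ∈ [n] (1-indexed), as in the paper
star : ℕ → ℕ → ℕ
star n i = if isEven i then i ∸ 1 else (if (suc i ℕ.≤ᵇ n) then suc i else n)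

-- σ⁻¹(i) for 1-indexed value i ∈ [n], as a 1-indexed position (0 outside [n], never used)
pos : ∀ {n} → Perm n → ℕ → ℕ
pos {n} σ zero = 0
pos {n} σ (suc i) with suc i ℕ.≤? n
... | Relation.Nullary.yes p = suc (toℕ (σ ⟨$⟩ˡ fromℕ< p))
... | Relation.Nullary.no _ = 0

IsWachs : ∀ {n} → Perm n → Set
IsWachs {n} σ = ∀ i → 1 ≤ i → i ≤ n ∸ 1 → ∣ pos σ i - pos σ (star n i) ∣ ≤ 1

W : ℕ → Set
W n = Σ (Perm n) IsWachs

_≤W_ : ∀ {n} → W n → W n → Set
x ≤W y = proj₁ x ≤R proj₁ y

_≈W_ : ∀ {n} → W n → W n → Set
x ≈W y = proj₁ x ≈ proj₁ y

Prod : ℕ → ℕ → Set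
Prod m k = Perm m × Subset k

_≤P_ : ∀ {m k} → Prod m k → Prod m k → Set
(u , A) ≤P (v , B) = (u ≤R v) × (A ⊆ B)

_≈P_ : ∀ {m k} → Prod m k → Prod m k → Set
(u , A) ≈P (v , B) = (u ≈ v) × (A ≡ B)

record OrderIso {A B : Set} (_≈A_ _≤A_ : A → A → Set) (_≈B_ _≤B_ : B → B → Set) : Set where
  field
    to        : A → B
    from      : B → A
    to-from   : ∀ b → to (from b) ≈B b
    from-to   : ∀ a → from (to a) ≈A a
    monotone  : ∀ a a' → a ≤A a' → to a ≤B to a'
    to-mono   : ∀ a a' → a ≤A a' → to a ≤B to a'
    to-refl   : ∀ a a' → to a ≤B to a' → a ≤A a'
    from-mono : ∀ b b' → b ≤B b' → from b ≤A from b'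

IsComplementedLattice : (A : Set) → (A → A → Set) → Set
IsComplementedLattice A _≤_ =
  Σ A λ bot → Σ A λ top →
    (∀ x → bot ≤ x) × (∀ x → x ≤ top)
  × (∀ x y → Σ A λ m → (m ≤ x) × (m ≤ y) × (∀ z → z ≤ x → z ≤ y → z ≤ m))
  × (∀ x y → Σ A λ j → (x ≤ j) × (y ≤ j) × (∀ z → x ≤ z → y ≤ z → j ≤ z))
  × (∀ x → Σ A λ y → (∀ z → z ≤ x → z ≤ y → z ≤ bot)
                    × (∀ z → x ≤ z → y ≤ z → top ≤ z))

-- The right weak order is inclusion of inversion sets: a cover u ⋖ u sᵢ (an ascent, since it
-- raises ℓ by one) inverts exactly the two values at positions i, i+1, and conversely if the
-- inversions of u are among those of v, then u climbs to v one inverted ascent at a time. In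
-- these terms Sₘ is a complemented lattice: the join of u and v inverts the transitive closure
-- of their inversions, the complement of u is u read backwards, and meets are dual to joins.
--
-- Group the values into blocks {2k, 2k+1}. A Wachs permutation keeps every block in adjacent
-- positions, so it is determined by the order τ(σ) in which the ⌈n/2⌉ blocks appear and by the
-- set of two-element blocks it lists in decreasing order. Inversions between different blocks are
-- the inversions of τ(σ), those inside a block are the flipped blocks, so σ ↦ (τ(σ), flipped
-- blocks) is an order isomorphism onto S⌈n/2⌉ × P([⌊n/2⌋]), which carries the lattice structure back.

module Submission where

open import Defs
open import Level using (0ℓ)
open import Data.Nat as ℕ using (ℕ; zero; suc; _+_; _∸_; _≤_; _<_; z≤n; s≤s; ∣_-_∣; ⌈_/2⌉; ⌊_/2⌋)
import Data.Nat.Properties as ℕ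
open import Data.Bool using (Bool; true; false)
open import Data.Bool.Properties using (T-≡)
open import Data.Empty using (⊥)
open import Data.Fin as Fin using (Fin; toℕ; fromℕ<; inject₁; inject≤; opposite; punchOut; _≟_)
  renaming (zero to fzero; suc to fsuc)
open import Data.Fin.Properties
  using ( toℕ-injective; toℕ<n; toℕ-fromℕ<; fromℕ<-toℕ; toℕ-inject₁; toℕ-inject≤; inject≤-injective; ≤̄⇒inject₁<
        ; opposite-prop; opposite-involutive; suc-injective; punchOut-injective; <⇒notInjective
        ; <-cmp; <-irrefl; <-asym; <-trans; <⇒≢; any?)
open import Data.Fin.Induction using (<-weakInduction; <-weakInduction-startingFrom)
open import Data.Fin.Permutation
  using (_⟨$⟩ʳ_; _⟨$⟩ˡ_; inverseˡ; inverseʳ; _≈_; _∘ₚ_; reverse; id; permutation)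
open import Data.Fin.Subset using (Subset; _⊆_; _∈_; _∩_; _∪_; ∁) renaming (⊥ to ∅; ⊤ to full)
open import Data.Fin.Subset.Properties
  using (⊆-min; ⊆-max; ⊆-antisym; p∩q⊆p; p∩q⊆q; x∈p∩q⁺; x∈p∪q⁻; p⊆p∪q; q⊆p∪q; x∈∁p⇒x∉p; x∉p⇒x∈∁p; _∈?_)
open import Data.List using (List; length; filter; cartesianProduct; allFin; map; tabulate; _++_)
open import Data.List.Properties using (filter-++; length-++; length-filter; filter-≐)
import Data.Vec as Vec
open import Data.Vec.Properties using (lookup∘tabulate; []=⇒lookup; lookup⇒[]=)
open import Data.Product using (Σ; ∃; _×_; _,_; proj₁; proj₂)
open import Data.Sum using (_⊎_; inj₁; inj₂; [_,_]′; swap)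
open import Function using (_∘_)
open import Function.Bundles using (_⇔_; mk⇔; Equivalence)
open import Function.Definitions using (Injective)
open import Function.Properties.Equivalence using (⇔-isEquivalence)
open import Relation.Nullary using (¬_; Dec; yes; no; does; contradiction)
open import Relation.Nullary.Decidable using (_×-dec_; _⊎-dec_; ¬?; dec-true; dec-false)
open import Relation.Unary using (Decidable)
open import Relation.Binary.Definitions using (Tri; tri<; tri≈; tri>)
open import Relation.Binary.Structures using (IsEquivalence)
open import Relation.Binary.PropositionalEquality hiding (J)
open import Relation.Binary.Construct.Closure.ReflexiveTransitive using (Star; ε; _◅_)
open import Algebra.Properties.CommutativeMonoid.Sum ℕ.+-0-commutativeMonoid
  using (sum; sum-cong-≗; sum-replicate-zero; ∑-distrib-+; sum-permute)

open IsEquivalence (⇔-isEquivalence {0ℓ}) using () renaming (refl to ⇔-refl; sym to ⇔-sym; trans to ⇔-trans)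

𝕀 : ∀ {P : Set} → Dec P → ℕ
𝕀 (yes _) = 1
𝕀 (no _)  = 0

𝕀-yes : ∀ {P : Set} (P? : Dec P) → P → 𝕀 P? ≡ 1
𝕀-yes (yes _) _  = refl
𝕀-yes (no ¬p) p = contradiction p ¬p

𝕀-no : ∀ {P : Set} (P? : Dec P) → ¬ P → 𝕀 P? ≡ 0
𝕀-no (yes p) ¬p = contradiction p ¬p
𝕀-no (no _)  _  = refl

𝕀-cong : ∀ {P Q : Set} (P? : Dec P) (Q? : Dec Q) → (P → Q) → (Q → P) → 𝕀 P? ≡ 𝕀 Q?
𝕀-cong (yes _) (yes _) _ _ = refl
𝕀-cong (yes p) (no ¬q) f _ = contradiction (f p) ¬q
𝕀-cong (no ¬p) (yes q) _ g = contradiction (g q) ¬p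
𝕀-cong (no _)  (no _)  _ _ = refl

𝕀≤1 : ∀ {P : Set} (P? : Dec P) → 𝕀 P? ≤ 1
𝕀≤1 (yes _) = s≤s z≤n
𝕀≤1 (no _)  = z≤n

sum-const-1 : ∀ n → sum {n} (λ _ → 1) ≡ n
sum-const-1 zero    = refl
sum-const-1 (suc n) = cong suc (sum-const-1 n)

sum-mono-≤ : ∀ {n} {f g : Fin n → ℕ} → (∀ i → f i ≤ g i) → sum f ≤ sum g
sum-mono-≤ {zero}  f≤g = z≤n
sum-mono-≤ {suc n} f≤g = ℕ.+-mono-≤ (f≤g fzero) (sum-mono-≤ (f≤g ∘ fsuc))

sum-mono-< : ∀ {n} {f g : Fin n → ℕ} → (∀ i → f i ≤ g i) → ∀ j → f j < g j → sum f < sum g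
sum-mono-< {suc n} f≤g fzero    fj<gj = ℕ.+-mono-<-≤ fj<gj (sum-mono-≤ (f≤g ∘ fsuc))
sum-mono-< {suc n} f≤g (fsuc j) fj<gj = ℕ.+-mono-≤-< (f≤g fzero) (sum-mono-< (f≤g ∘ fsuc) j fj<gj)

sum-𝕀-≡ : ∀ {n} (q : Fin n) → sum (λ i → 𝕀 (i ≟ q)) ≡ 1
sum-𝕀-≡ {suc n} fzero =
  cong suc (trans (sum-cong-≗ {n} (λ i → 𝕀-no (fsuc i ≟ fzero) λ ())) (sum-replicate-zero n))
sum-𝕀-≡ {suc n} (fsuc q) rewrite 𝕀-no (fzero ≟ fsuc q) (λ ()) =
  trans (sum-cong-≗ (λ i → 𝕀-cong (fsuc i ≟ fsuc q) (i ≟ q) suc-injective (cong fsuc))) (sum-𝕀-≡ q)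

sum-𝕀-≡² : ∀ {m n} (q : Fin m) (r : Fin n) → sum (λ i → sum (λ j → 𝕀 ((i ≟ q) ×-dec (j ≟ r)))) ≡ 1
sum-𝕀-≡² {m} {n} q r = trans (sum-cong-≗ {m} row) (sum-𝕀-≡ q)
  where
    row : ∀ i → sum (λ j → 𝕀 ((i ≟ q) ×-dec (j ≟ r))) ≡ 𝕀 (i ≟ q)
    row i with i ≟ q
    ... | yes i≡q = trans (sum-cong-≗ {n} (λ j → 𝕀-cong ((yes i≡q) ×-dec (j ≟ r)) (j ≟ r) proj₂ (i≡q ,_)))
                          (sum-𝕀-≡ r)
    ... | no i≢q = trans (sum-cong-≗ {n} (λ j → 𝕀-no ((no i≢q) ×-dec (j ≟ r)) (λ (i≡q , _) → i≢q i≡q)))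
                         (sum-replicate-zero n)

𝕀-⊎ : ∀ {P Q : Set} (P? : Dec P) (Q? : Dec Q) → ¬ (P × Q) → 𝕀 (P? ⊎-dec Q?) ≡ 𝕀 P? + 𝕀 Q?
𝕀-⊎ (yes p) (yes q) ¬PQ = contradiction (p , q) ¬PQ
𝕀-⊎ (yes _) (no _)  _   = refl
𝕀-⊎ (no _)  (yes _) _   = refl
𝕀-⊎ (no _)  (no _)  _   = refl

module _ {A B : Set} {P : A × B → Set} (P? : Decidable P) where

  length-filter-tabulate : ∀ {n} (f : Fin n → B) (a : A) →
    length (filter P? (map (a ,_) (tabulate f))) ≡ sum (λ i → 𝕀 (P? (a , f i)))
  length-filter-tabulate {zero}  f a = refl
  length-filter-tabulate {suc n} f a with P? (a , f fzero)
  ... | yes _ = cong suc (length-filter-tabulate (f ∘ fsuc) a)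
  ... | no _  = length-filter-tabulate (f ∘ fsuc) a

  length-filter-cartesianProduct : ∀ {m n} (f : Fin m → A) (g : Fin n → B) →
    length (filter P? (cartesianProduct (tabulate f) (tabulate g)))
      ≡ sum (λ i → sum (λ j → 𝕀 (P? (f i , g j))))
  length-filter-cartesianProduct {zero}  f g = refl
  length-filter-cartesianProduct {suc m} f g = begin
    length (filter P? (row ++ rest))                    ≡⟨ cong length (filter-++ P? row rest) ⟩
    length (filter P? row ++ filter P? rest)            ≡⟨ length-++ (filter P? row) ⟩
    length (filter P? row) + length (filter P? rest)    ≡⟨ cong₂ _+_ (length-filter-tabulate g (f fzero))
                                                            (length-filter-cartesianProduct (f ∘ fsuc) g) ⟩
    _                                                   ∎
    where
      open ≡-Reasoning
      row = map (f fzero ,_) (tabulate g)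
      rest = cartesianProduct (tabulate (f ∘ fsuc)) (tabulate g)

IsComplementedLattice-⇔ : ∀ {A : Set} {R S : A → A → Set} →
  (∀ {x y} → R x y → S x y) → (∀ {x y} → S x y → R x y) →
  IsComplementedLattice A R → IsComplementedLattice A S
IsComplementedLattice-⇔ R⇒S S⇒R (bot , top , bot≤ , ≤top , meet , join , compl) =
    bot , top , (λ x → R⇒S (bot≤ x)) , (λ x → R⇒S (≤top x))
  , (λ x y → let (w , w≤x , w≤y , glb) = meet x y
             in w , R⇒S w≤x , R⇒S w≤y , λ z z≤x z≤y → R⇒S (glb z (S⇒R z≤x) (S⇒R z≤y)))
  , (λ x y → let (w , x≤w , y≤w , lub) = join x y
             in w , R⇒S x≤w , R⇒S y≤w , λ z x≤z y≤z → R⇒S (lub z (S⇒R x≤z) (S⇒R y≤z)))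
  , (λ x → let (x′ , disjoint , covering) = compl x
           in x′ , (λ z z≤x z≤x′ → R⇒S (disjoint z (S⇒R z≤x) (S⇒R z≤x′)))
                 , (λ z x≤z x′≤z → R⇒S (covering z (S⇒R x≤z) (S⇒R x′≤z))))

IsComplementedLattice-× : ∀ {A B : Set} {R : A → A → Set} {S : B → B → Set} →
  IsComplementedLattice A R → IsComplementedLattice B S →
  IsComplementedLattice (A × B) (λ p q → R (proj₁ p) (proj₁ q) × S (proj₂ p) (proj₂ q))
IsComplementedLattice-× (bot₁ , top₁ , bot≤₁ , ≤top₁ , meet₁ , join₁ , compl₁)
                        (bot₂ , top₂ , bot≤₂ , ≤top₂ , meet₂ , join₂ , compl₂) =
    (bot₁ , bot₂) , (top₁ , top₂) , (λ (x₁ , x₂) → bot≤₁ x₁ , bot≤₂ x₂) , (λ (x₁ , x₂) → ≤top₁ x₁ , ≤top₂ x₂)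
  , (λ (x₁ , x₂) (y₁ , y₂) →
       let (w₁ , w≤x₁ , w≤y₁ , glb₁) = meet₁ x₁ y₁
           (w₂ , w≤x₂ , w≤y₂ , glb₂) = meet₂ x₂ y₂
       in (w₁ , w₂) , (w≤x₁ , w≤x₂) , (w≤y₁ , w≤y₂)
        , λ (z₁ , z₂) (z≤x₁ , z≤x₂) (z≤y₁ , z≤y₂) → glb₁ z₁ z≤x₁ z≤y₁ , glb₂ z₂ z≤x₂ z≤y₂)
  , (λ (x₁ , x₂) (y₁ , y₂) →
       let (w₁ , x≤w₁ , y≤w₁ , lub₁) = join₁ x₁ y₁
           (w₂ , x≤w₂ , y≤w₂ , lub₂) = join₂ x₂ y₂
       in (w₁ , w₂) , (x≤w₁ , x≤w₂) , (y≤w₁ , y≤w₂)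
        , λ (z₁ , z₂) (x≤z₁ , x≤z₂) (y≤z₁ , y≤z₂) → lub₁ z₁ x≤z₁ y≤z₁ , lub₂ z₂ x≤z₂ y≤z₂)
  , (λ (x₁ , x₂) →
       let (x′₁ , disjoint₁ , covering₁) = compl₁ x₁
           (x′₂ , disjoint₂ , covering₂) = compl₂ x₂
       in (x′₁ , x′₂)
        , (λ (z₁ , z₂) (z≤x₁ , z≤x₂) (z≤x′₁ , z≤x′₂) → disjoint₁ z₁ z≤x₁ z≤x′₁ , disjoint₂ z₂ z≤x₂ z≤x′₂)
        , (λ (z₁ , z₂) (x≤z₁ , x≤z₂) (x′≤z₁ , x′≤z₂) → covering₁ z₁ x≤z₁ x′≤z₁ , covering₂ z₂ x≤z₂ x′≤z₂))

Subset-complementedLattice : ∀ k → IsComplementedLattice (Subset k) _⊆_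
Subset-complementedLattice k =
    ∅ , full , ⊆-min , ⊆-max
  , (λ p q → p ∩ q , p∩q⊆p p q , p∩q⊆q p q , λ r r⊆p r⊆q i∈r → x∈p∩q⁺ (r⊆p i∈r , r⊆q i∈r))
  , (λ p q → p ∪ q , p⊆p∪q q , q⊆p∪q p q , λ r p⊆r q⊆r i∈p∪q → [ p⊆r , q⊆r ]′ (x∈p∪q⁻ p q i∈p∪q))
  , (λ p → ∁ p , (λ r r⊆p r⊆∁p i∈r → contradiction (r⊆p i∈r) (x∈∁p⇒x∉p (r⊆∁p i∈r)))
               , (λ r p⊆r ∁p⊆r {i} _ → covering r p⊆r ∁p⊆r i))
  where
    covering : ∀ {p} r → p ⊆ r → ∁ p ⊆ r → ∀ i → i ∈ r
    covering {p} r p⊆r ∁p⊆r i with i ∈? p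
    ... | yes i∈p = p⊆r i∈p
    ... | no i∉p = ∁p⊆r (x∉p⇒x∈∁p i∉p)

IsComplementedLattice-retract : ∀ {A B : Set} {R : A → A → Set} {S : B → B → Set} (to : A → B) (from : B → A) →
  (∀ {a a′} → R a a′ → S (to a) (to a′)) → (∀ {a a′} → S (to a) (to a′) → R a a′) →
  (∀ b → S (to (from b)) b) → (∀ b → S b (to (from b))) → (∀ {x y z} → S x y → S y z → S x z) →
  IsComplementedLattice B S → IsComplementedLattice A R
IsComplementedLattice-retract to from mono reflect to-from≤ ≤to-from S-trans
                              (bot , top , bot≤ , ≤top , meet , join , compl) =
    from bot , from top
  , (λ x → reflect (S-trans (to-from≤ bot) (bot≤ (to x))))
  , (λ x → reflect (S-trans (≤top (to x)) (≤to-from top)))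
  , (λ x y → let (w , w≤x , w≤y , glb) = meet (to x) (to y)
             in from w , reflect (S-trans (to-from≤ w) w≤x) , reflect (S-trans (to-from≤ w) w≤y)
              , λ z z≤x z≤y → reflect (S-trans (glb (to z) (mono z≤x) (mono z≤y)) (≤to-from w)))
  , (λ x y → let (w , x≤w , y≤w , lub) = join (to x) (to y)
             in from w , reflect (S-trans x≤w (≤to-from w)) , reflect (S-trans y≤w (≤to-from w))
              , λ z x≤z y≤z → reflect (S-trans (to-from≤ w) (lub (to z) (mono x≤z) (mono y≤z))))
  , (λ x → let (x′ , disjoint , covering) = compl (to x)
           in from x′
            , (λ z z≤x z≤x′ → reflect (S-trans (disjoint (to z) (mono z≤x) (S-trans (mono z≤x′) (to-from≤ x′)))
                                              (≤to-from bot)))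
            , (λ z x≤z x′≤z → reflect (S-trans (to-from≤ top)
                                              (covering (to z) (mono x≤z) (S-trans (≤to-from x′) (mono x′≤z))))))

⟨$⟩ʳ-injective : ∀ {n} (σ : Perm n) {x y} → σ ⟨$⟩ʳ x ≡ σ ⟨$⟩ʳ y → x ≡ y
⟨$⟩ʳ-injective σ {x} {y} e = trans (sym (inverseˡ σ)) (trans (cong (σ ⟨$⟩ˡ_) e) (inverseˡ σ))

⟨$⟩ˡ-injective : ∀ {n} (σ : Perm n) {x y} → σ ⟨$⟩ˡ x ≡ σ ⟨$⟩ˡ y → x ≡ y
⟨$⟩ˡ-injective σ {x} {y} e = trans (sym (inverseʳ σ)) (trans (cong (σ ⟨$⟩ʳ_) e) (inverseʳ σ))

≈⇒⟨$⟩ˡ-≡ : ∀ {n} {u v : Perm n} → u ≈ v → ∀ a → u ⟨$⟩ˡ a ≡ v ⟨$⟩ˡ a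
≈⇒⟨$⟩ˡ-≡ {u = u} {v} u≈v a =
  ⟨$⟩ʳ-injective v (trans (sym (u≈v (u ⟨$⟩ˡ a))) (trans (inverseʳ u) (sym (inverseʳ v))))

opposite-< : ∀ {n} {i j : Fin n} → i Fin.< j → opposite j Fin.< opposite i
opposite-< {n} {i} {j} i<j = subst₂ _<_ (sym (opposite-prop j)) (sym (opposite-prop i))
  (ℕ.∸-monoʳ-< (s≤s i<j) (toℕ<n j))

StrictlyMonotone : ∀ {n} → (Fin n → Fin n) → Set
StrictlyMonotone f = ∀ {x y} → x Fin.< y → f x Fin.< f y

strictlyMonotone⇒inflationary : ∀ {n} (f : Fin n → Fin n) → StrictlyMonotone f → ∀ x → toℕ x ≤ toℕ (f x)
strictlyMonotone⇒inflationary {suc n} f mono = <-weakInduction (λ x → toℕ x ≤ toℕ (f x)) z≤n step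
  where
    step : ∀ i → toℕ (inject₁ i) ≤ toℕ (f (inject₁ i)) → toℕ (fsuc i) ≤ toℕ (f (fsuc i))
    step i hyp = ℕ.≤-trans (s≤s (subst (λ k → k ≤ toℕ (f (inject₁ i))) (toℕ-inject₁ i) hyp))
                           (mono (≤̄⇒inject₁< ℕ.≤-refl))

-- The same bound for f conjugated by the order reversal gives f x ≤ x.
strictlyMonotone⇒≡id : ∀ {n} (f : Fin n → Fin n) → StrictlyMonotone f → ∀ x → f x ≡ x
strictlyMonotone⇒≡id f mono x = toℕ-injective (ℕ.≤-antisym fx≤x (strictlyMonotone⇒inflationary f mono x))
  where
    f̃ = λ y → opposite (f (opposite y))
    f̃-mono : StrictlyMonotone f̃
    f̃-mono y<z = opposite-< (mono (opposite-< y<z))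
    fx≤x : toℕ (f x) ≤ toℕ x
    fx≤x = ℕ.≮⇒≥ λ x<fx → ℕ.<⇒≱ (opposite-< x<fx)
      (subst (λ y → toℕ (opposite x) ≤ toℕ (opposite (f y))) (opposite-involutive x)
        (strictlyMonotone⇒inflationary f̃ f̃-mono (opposite x)))

Before : ∀ {n} → Perm n → Fin n → Fin n → Set
Before σ a b = σ ⟨$⟩ˡ a Fin.< σ ⟨$⟩ˡ b

Before-total : ∀ {n} (σ : Perm n) {a b} → a ≢ b → Before σ a b ⊎ Before σ b a
Before-total σ {a} {b} a≢b with <-cmp (σ ⟨$⟩ˡ a) (σ ⟨$⟩ˡ b)
... | tri< lt _ _ = inj₁ lt
... | tri≈ _ eq _ = contradiction (⟨$⟩ˡ-injective σ eq) a≢b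
... | tri> _ _ gt = inj₂ gt

Before-⟨$⟩ʳ : ∀ {n} (σ : Perm n) {x y} → x Fin.< y → Before σ (σ ⟨$⟩ʳ x) (σ ⟨$⟩ʳ y)
Before-⟨$⟩ʳ σ = subst₂ Fin._<_ (sym (inverseˡ σ)) (sym (inverseˡ σ))

consecutive⇒strictlyMonotone : ∀ {m} (f : Fin (suc m) → Fin (suc m)) →
  (∀ i → f (inject₁ i) Fin.< f (fsuc i)) → StrictlyMonotone f
consecutive⇒strictlyMonotone f cons {x} {y} x<y =
  <-weakInduction-startingFrom (λ z → x Fin.< z → f x Fin.< f z) (λ x<x → contradiction x<x (<-irrefl refl))
    step (ℕ.<⇒≤ x<y) x<y
  where
    step : ∀ j → (x Fin.< inject₁ j → f x Fin.< f (inject₁ j)) → x Fin.< fsuc j → f x Fin.< f (fsuc j)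
    step j hyp x<1+j with <-cmp x (inject₁ j)
    ... | tri< x<j _ _ = <-trans (hyp x<j) (cons j)
    ... | tri≈ _ refl _ = cons j
    ... | tri> _ _ j<x = contradiction (subst (_< toℕ x) (toℕ-inject₁ j) j<x) (ℕ.≤⇒≯ (ℕ.≤-pred x<1+j))

⟨$⟩ˡ∘⟨$⟩ʳ-strictlyMonotone⇒≈ : ∀ {n} (u v : Perm n) → StrictlyMonotone (λ x → v ⟨$⟩ˡ (u ⟨$⟩ʳ x)) → u ≈ v
⟨$⟩ˡ∘⟨$⟩ʳ-strictlyMonotone⇒≈ u v mono x =
  trans (sym (inverseʳ v)) (cong (v ⟨$⟩ʳ_) (strictlyMonotone⇒≡id (λ y → v ⟨$⟩ˡ (u ⟨$⟩ʳ y)) mono x))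

Before-⊆⇒≈ : ∀ {n} (u v : Perm n) → (∀ a b → Before u a b → Before v a b) → u ≈ v
Before-⊆⇒≈ u v u⊆v = ⟨$⟩ˡ∘⟨$⟩ʳ-strictlyMonotone⇒≈ u v (λ y<z → u⊆v _ _ (Before-⟨$⟩ʳ u y<z))

_⊆Inv_ : ∀ {n} → Perm n → Perm n → Set
u ⊆Inv v = ∀ a b → a Fin.< b → Before u b a → Before v b a

⊆Inv-refl : ∀ {n} {u : Perm n} → u ⊆Inv u
⊆Inv-refl _ _ _ ba = ba

⊆Inv-trans : ∀ {n} {u v w : Perm n} → u ⊆Inv v → v ⊆Inv w → u ⊆Inv w
⊆Inv-trans u⊆v v⊆w a b a<b ba = v⊆w a b a<b (u⊆v a b a<b ba)

⊆Inv-respʳ-≈ : ∀ {n} {u v w : Perm n} → u ⊆Inv v → v ≈ w → u ⊆Inv w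
⊆Inv-respʳ-≈ {v = v} {w} u⊆v v≈w a b a<b ba =
  subst₂ Fin._<_ (≈⇒⟨$⟩ˡ-≡ {u = v} {w} v≈w b) (≈⇒⟨$⟩ˡ-≡ {u = v} {w} v≈w a) (u⊆v a b a<b ba)

≈⇒⊆Inv : ∀ {n} {u v : Perm n} → u ≈ v → u ⊆Inv v
≈⇒⊆Inv {u = u} {v} = ⊆Inv-respʳ-≈ {u = u} {u} {v} (⊆Inv-refl {u = u})

IsInversion : ∀ {n} → Perm n → Fin n × Fin n → Set
IsInversion σ jk = proj₁ jk Fin.< proj₂ jk × σ ⟨$⟩ʳ proj₂ jk Fin.< σ ⟨$⟩ʳ proj₁ jk

inversion? : ∀ {n} (σ : Perm n) → Decidable (IsInversion σ)
inversion? σ jk = (proj₁ jk Fin.<? proj₂ jk) ×-dec (σ ⟨$⟩ʳ proj₂ jk Fin.<? σ ⟨$⟩ʳ proj₁ jk)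

allPairs : ∀ n → List (Fin n × Fin n)
allPairs n = cartesianProduct (allFin n) (allFin n)

𝕀-inversion : ∀ {n} → Perm n → Fin n → Fin n → ℕ
𝕀-inversion σ j k = 𝕀 (inversion? σ (j , k))

ℓ≡sum : ∀ {n} (σ : Perm n) → ℓ σ ≡ sum (λ j → sum (𝕀-inversion σ j))
ℓ≡sum σ = length-filter-cartesianProduct (inversion? σ) (λ x → x) (λ x → x)

ℓ-cong : ∀ {n} {u v : Perm n} → u ≈ v → ℓ u ≡ ℓ v
ℓ-cong {n} {u} {v} u≈v = cong length (filter-≐ (inversion? u) (inversion? v) (to , from) (allPairs n))
  where
    to : ∀ {jk} → IsInversion u jk → IsInversion v jk
    to {j , k} (j<k , uk<uj) = j<k , subst₂ Fin._<_ (u≈v k) (u≈v j) uk<uj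
    from : ∀ {jk} → IsInversion v jk → IsInversion u jk
    from {j , k} (j<k , vk<vj) = j<k , subst₂ Fin._<_ (sym (u≈v k)) (sym (u≈v j)) vk<vj

ℓ-bounded : ∀ {n} (σ : Perm n) → ℓ σ ≤ length (allPairs n)
ℓ-bounded {n} σ = length-filter (inversion? σ) (allPairs n)

module AdjacentTransposition {n : ℕ} (i : ℕ) (p : suc i < n) where

  I J : Fin n
  I = fromℕ< (ℕ.≤-pred (ℕ.m<n⇒m<1+n p))
  J = fromℕ< p

  toℕ-I : toℕ I ≡ i
  toℕ-I = toℕ-fromℕ< _

  toℕ-J : toℕ J ≡ suc (toℕ I)
  toℕ-J = trans (toℕ-fromℕ< p) (cong suc (sym toℕ-I))

  I<J : I Fin.< J
  I<J = subst (toℕ I <_) (sym toℕ-J) ℕ.≤-refl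

  I<⇒J≤ : ∀ {z : Fin n} → I Fin.< z → J Fin.≤ z
  I<⇒J≤ {z} = subst (_≤ toℕ z) (sym toℕ-J)

  t : Fin n → Fin n
  t x = s i p ⟨$⟩ʳ x

  t-I : t I ≡ J
  t-I rewrite dec-true (I ≟ I) refl = refl

  t-J : t J ≡ I
  t-J rewrite dec-false (J ≟ I) (λ J≡I → <⇒≢ I<J (sym J≡I)) | dec-true (J ≟ J) refl = refl

  t-fix : ∀ {x} → x ≢ I → x ≢ J → t x ≡ x
  t-fix {x} x≢I x≢J rewrite dec-false (x ≟ I) x≢I | dec-false (x ≟ J) x≢J = refl

  t-involutive : ∀ x → t (t x) ≡ x
  t-involutive x = by-cases (x ≟ I) (x ≟ J)
    where
      by-cases : Dec (x ≡ I) → Dec (x ≡ J) → t (t x) ≡ x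
      by-cases (yes refl) _        = trans (cong t t-I) t-J
      by-cases (no _)     (yes refl) = trans (cong t t-J) t-I
      by-cases (no x≢I)   (no x≢J) = trans (cong t (t-fix x≢I x≢J)) (t-fix x≢I x≢J)

  t-mono : ∀ x y → x Fin.< y → ¬ (x ≡ I × y ≡ J) → t x Fin.< t y
  t-mono x y x<y ¬IJ = by-cases (x ≟ I) (x ≟ J) (y ≟ I) (y ≟ J)
    where
      by-cases : Dec (x ≡ I) → Dec (x ≡ J) → Dec (y ≡ I) → Dec (y ≡ J) → t x Fin.< t y
      by-cases (yes refl) _ (yes refl) _ = contradiction x<y (<-irrefl refl)
      by-cases (yes refl) _ (no _) (yes refl) = contradiction (refl , refl) ¬IJ
      by-cases (yes refl) _ (no y≢I) (no y≢J) rewrite t-I | t-fix y≢I y≢J =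
        ℕ.≤∧≢⇒< (I<⇒J≤ x<y) (λ eq → y≢J (toℕ-injective (sym eq)))
      by-cases (no _) (yes refl) (yes refl) _ = contradiction (<-trans x<y I<J) (<-irrefl refl)
      by-cases (no _) (yes refl) (no _) (yes refl) = contradiction x<y (<-irrefl refl)
      by-cases (no _) (yes refl) (no y≢I) (no y≢J) rewrite t-J | t-fix y≢I y≢J = <-trans I<J x<y
      by-cases (no x≢I) (no x≢J) (yes refl) _ rewrite t-I | t-fix x≢I x≢J = <-trans x<y I<J
      by-cases (no x≢I) (no x≢J) (no _) (yes refl) rewrite t-J | t-fix x≢I x≢J =
        ℕ.≤∧≢⇒< (ℕ.≤-pred (subst (toℕ x <_) toℕ-J x<y)) (λ eq → x≢I (toℕ-injective eq))
      by-cases (no x≢I) (no x≢J) (no y≢I) (no y≢J) rewrite t-fix x≢I x≢J | t-fix y≢I y≢J = x<y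

  δ : Fin n → Fin n → ℕ
  δ j k = 𝕀 ((j ≟ J) ×-dec (k ≟ I))

  t-mono⁻ : ∀ x y → t x Fin.< t y → ¬ (x ≡ J × y ≡ I) → x Fin.< y
  t-mono⁻ x y tx<ty ¬JI = subst₂ Fin._<_ (t-involutive x) (t-involutive y) (t-mono (t x) (t y) tx<ty ¬IJ)
    where
      ¬IJ : ¬ (t x ≡ I × t y ≡ J)
      ¬IJ (tx≡I , ty≡J) = ¬JI ( trans (sym (t-involutive x)) (trans (cong t tx≡I) t-I)
                              , trans (sym (t-involutive y)) (trans (cong t ty≡J) t-J))

  s⟨$⟩ˡ≡t : ∀ x → s i p ⟨$⟩ˡ x ≡ t x
  s⟨$⟩ˡ≡t x = trans (sym (t-involutive (s i p ⟨$⟩ˡ x))) (cong t (inverseʳ (s i p) {x}))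

  module _ (u : Perm n) where

    us : Perm n
    us = u ·s[ i , p ]

    Before-·s⁺ : ∀ {a b} → Before u a b → ¬ (u ⟨$⟩ˡ a ≡ I × u ⟨$⟩ˡ b ≡ J) → Before us a b
    Before-·s⁺ {a} {b} ab ¬IJ = subst₂ Fin._<_ (sym (s⟨$⟩ˡ≡t (u ⟨$⟩ˡ a))) (sym (s⟨$⟩ˡ≡t (u ⟨$⟩ˡ b)))
      (t-mono (u ⟨$⟩ˡ a) (u ⟨$⟩ˡ b) ab ¬IJ)

    Before-·s⁻ : ∀ {a b} → Before us a b → ¬ (u ⟨$⟩ˡ a ≡ J × u ⟨$⟩ˡ b ≡ I) → Before u a b
    Before-·s⁻ {a} {b} ab ¬JI = t-mono⁻ (u ⟨$⟩ˡ a) (u ⟨$⟩ˡ b)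
      (subst₂ Fin._<_ (s⟨$⟩ˡ≡t (u ⟨$⟩ˡ a)) (s⟨$⟩ˡ≡t (u ⟨$⟩ˡ b)) ab) ¬JI

    module _ (asc : u ⟨$⟩ʳ I Fin.< u ⟨$⟩ʳ J) where

      ascent⇒⊆Inv : u ⊆Inv us
      ascent⇒⊆Inv a b a<b ba = Before-·s⁺ ba λ (b≡uI , a≡uJ) → <-asym a<b
        (subst₂ Fin._<_ (trans (cong (u ⟨$⟩ʳ_) (sym b≡uI)) (inverseʳ u))
                        (trans (cong (u ⟨$⟩ʳ_) (sym a≡uJ)) (inverseʳ u)) asc)

      IsInversion-·s : ∀ {j k} → IsInversion us (t j , t k) → IsInversion u (j , k) ⊎ (j ≡ J × k ≡ I)
      IsInversion-·s {j} {k} (tj<tk , u[ttk]<u[ttj]) with (j ≟ J) ×-dec (k ≟ I)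
      ... | yes JI = inj₂ JI
      ... | no ¬JI = inj₁ (t-mono⁻ j k tj<tk ¬JI , subst₂ (λ x y → u ⟨$⟩ʳ x Fin.< u ⟨$⟩ʳ y)
                                                  (t-involutive k) (t-involutive j) u[ttk]<u[ttj])

      IsInversion-·s⁺ : ∀ {j k} → IsInversion u (j , k) ⊎ (j ≡ J × k ≡ I) → IsInversion us (t j , t k)
      IsInversion-·s⁺ {j} {k} (inj₁ (j<k , uk<uj)) =
          t-mono j k j<k (λ (j≡I , k≡J) → <-asym asc (subst₂ (λ x y → u ⟨$⟩ʳ x Fin.< u ⟨$⟩ʳ y) k≡J j≡I uk<uj))
        , subst₂ (λ x y → u ⟨$⟩ʳ x Fin.< u ⟨$⟩ʳ y) (sym (t-involutive k)) (sym (t-involutive j)) uk<uj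
      IsInversion-·s⁺ (inj₂ (refl , refl)) =
          subst₂ Fin._<_ (sym t-J) (sym t-I) I<J
        , subst₂ (λ x y → u ⟨$⟩ʳ x Fin.< u ⟨$⟩ʳ y) (sym (t-involutive I)) (sym (t-involutive J)) asc

      𝕀-inversion-·s : ∀ j k → 𝕀-inversion us (t j) (t k) ≡ 𝕀-inversion u j k + δ j k
      𝕀-inversion-·s j k = trans (𝕀-cong _ (inversion? u (j , k) ⊎-dec JI?) IsInversion-·s IsInversion-·s⁺)
                                 (𝕀-⊎ (inversion? u (j , k)) JI? λ { ((J<I , _) , (refl , refl)) → <-asym I<J J<I })
        where JI? = (j ≟ J) ×-dec (k ≟ I)

      ℓ-ascent : ℓ us ≡ suc (ℓ u)
      ℓ-ascent = begin
        ℓ us                                                      ≡⟨ ℓ≡sum us ⟩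
        sum (λ j → sum (𝕀-inversion us j))                        ≡⟨ reindex ⟩
        sum (λ j → sum (λ k → 𝕀-inversion us (t j) (t k)))        ≡⟨ sum-cong-≗ {n} (λ j → sum-cong-≗ {n} (𝕀-inversion-·s j)) ⟩
        sum (λ j → sum (λ k → 𝕀-inversion u j k + δ j k))         ≡⟨ sum-cong-≗ {n} (λ j → ∑-distrib-+ (𝕀-inversion u j) (δ j)) ⟩
        sum (λ j → sum (𝕀-inversion u j) + sum (δ j))             ≡⟨ ∑-distrib-+ (λ j → sum (𝕀-inversion u j)) (λ j → sum (δ j)) ⟩
        sum (λ j → sum (𝕀-inversion u j)) + sum (λ j → sum (δ j)) ≡⟨ cong₂ _+_ (sym (ℓ≡sum u)) (sum-𝕀-≡² J I) ⟩
        ℓ u + 1                                                   ≡⟨ ℕ.+-comm (ℓ u) 1 ⟩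
        suc (ℓ u)                                                 ∎
        where
          open ≡-Reasoning
          reindex : sum (λ j → sum (𝕀-inversion us j)) ≡ sum (λ j → sum (λ k → 𝕀-inversion us (t j) (t k)))
          reindex = trans (sum-permute (λ j → sum (𝕀-inversion us j)) (s i p))
                          (sum-cong-≗ {n} (λ j → sum-permute (𝕀-inversion us (t j)) (s i p)))

-- The weak order is inclusion of inversion sets

⋖R⇒⊆Inv : ∀ {n} {u v : Perm n} → u ⋖R v → u ⊆Inv v
⋖R⇒⊆Inv {n} {u} {v} (i , p , v≈us , ℓv≡1+ℓu) = by-cases (<-cmp (u ⟨$⟩ʳ I) (u ⟨$⟩ʳ J))
  where
    open AdjacentTransposition i p
    by-cases : Tri (u ⟨$⟩ʳ I Fin.< u ⟨$⟩ʳ J) (u ⟨$⟩ʳ I ≡ u ⟨$⟩ʳ J) (u ⟨$⟩ʳ J Fin.< u ⟨$⟩ʳ I) → u ⊆Inv v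
    by-cases (tri< asc _ _) = ⊆Inv-respʳ-≈ {u = u} {us u} {v} (ascent⇒⊆Inv u asc) (λ x → sym (v≈us x))
    by-cases (tri≈ _ uI≡uJ _) = contradiction (⟨$⟩ʳ-injective u uI≡uJ) (<⇒≢ I<J)
    by-cases (tri> _ _ uJ<uI) = contradiction ℓu≡2+ℓu (ℕ.<⇒≢ (ℕ.<-trans (ℕ.n<1+n (ℓ u)) (ℕ.n<1+n _)))
      where
        -- a descent cannot be a cover: u is obtained back from us u by an ascent, so ℓ u = ℓ v + 1
        ascent-of-us : us u ⟨$⟩ʳ I Fin.< us u ⟨$⟩ʳ J
        ascent-of-us = subst₂ (λ x y → u ⟨$⟩ʳ x Fin.< u ⟨$⟩ʳ y) (sym t-I) (sym t-J) uJ<uI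
        ℓu≡2+ℓu : ℓ u ≡ suc (suc (ℓ u))
        ℓu≡2+ℓu = begin
          ℓ u                ≡⟨ ℓ-cong {u = u} {us (us u)} (λ x → cong (u ⟨$⟩ʳ_) (sym (t-involutive x))) ⟩
          ℓ (us (us u))      ≡⟨ ℓ-ascent (us u) ascent-of-us ⟩
          suc (ℓ (us u))     ≡⟨ cong suc (ℓ-cong {u = us u} {v} (λ x → sym (v≈us x))) ⟩
          suc (ℓ v)          ≡⟨ cong suc ℓv≡1+ℓu ⟩
          suc (suc (ℓ u))    ∎
          where open ≡-Reasoning

≤R⇒⊆Inv : ∀ {n} {u v : Perm n} → u ≤R v → u ⊆Inv v
≤R⇒⊆Inv {n} {u} {v} (w , u⋖*w , w≈v) = ⊆Inv-respʳ-≈ {u = u} {w} {v} (chain {u} {w} u⋖*w) w≈v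
  where
    chain : ∀ {x y : Perm n} → Star _⋖R_ x y → x ⊆Inv y
    chain {x} ε = ⊆Inv-refl {u = x}
    chain {x} {y} (_◅_ {j = z} x⋖z z⋖*y) = ⊆Inv-trans {u = x} {z} {y} (⋖R⇒⊆Inv {u = x} {z} x⋖z) (chain {z} {y} z⋖*y)

⊆Inv⇒≤R : ∀ {n} {u v : Perm n} → u ⊆Inv v → u ≤R v
⊆Inv⇒≤R {zero}  {u} {v} _   = u , ε , λ ()
⊆Inv⇒≤R {suc m} {u} {v} u⊆v = climb (length (allPairs (suc m))) u (ℕ.m≤m+n _ (ℓ u)) u⊆v
  where
    InvertedAscent : Perm (suc m) → Fin m → Set
    InvertedAscent w i = w ⟨$⟩ʳ inject₁ i Fin.< w ⟨$⟩ʳ fsuc i × Before v (w ⟨$⟩ʳ fsuc i) (w ⟨$⟩ʳ inject₁ i)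

    invertedAscent? : ∀ w i → Dec (InvertedAscent w i)
    invertedAscent? w i = (w ⟨$⟩ʳ inject₁ i Fin.<? w ⟨$⟩ʳ fsuc i)
                          ×-dec (v ⟨$⟩ˡ (w ⟨$⟩ʳ fsuc i) Fin.<? v ⟨$⟩ˡ (w ⟨$⟩ʳ inject₁ i))

    no-inverted-ascent⇒≈ : ∀ w → w ⊆Inv v → (∀ i → ¬ InvertedAscent w i) → w ≈ v
    no-inverted-ascent⇒≈ w w⊆v none =
      ⟨$⟩ˡ∘⟨$⟩ʳ-strictlyMonotone⇒≈ w v (consecutive⇒strictlyMonotone _ consecutive)
      where
        consecutive : ∀ i → Before v (w ⟨$⟩ʳ inject₁ i) (w ⟨$⟩ʳ fsuc i)
        consecutive i with <-cmp (w ⟨$⟩ʳ inject₁ i) (w ⟨$⟩ʳ fsuc i)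
        ... | tri< asc _ _ with Before-total v (<⇒≢ asc)
        ...   | inj₁ in-order = in-order
        ...   | inj₂ inverted = contradiction (asc , inverted) (none i)
        consecutive i | tri≈ _ eq _ = contradiction (⟨$⟩ʳ-injective w eq) (<⇒≢ (≤̄⇒inject₁< ℕ.≤-refl))
        consecutive i | tri> _ _ desc = w⊆v _ _ desc (Before-⟨$⟩ʳ w (≤̄⇒inject₁< ℕ.≤-refl))

    climb-step : ∀ w i → w ⊆Inv v → InvertedAscent w i → Σ (Perm (suc m)) λ w′ → w ⋖R w′ × w′ ⊆Inv v
    climb-step w i w⊆v (asc , inverted) = us w , (toℕ i , s≤s (toℕ<n i) , (λ _ → refl) , ℓ-ascent w asc′) , ws⊆v
      where
        open AdjacentTransposition (toℕ i) (s≤s (toℕ<n i))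
        I≡i : I ≡ inject₁ i
        I≡i = toℕ-injective (trans toℕ-I (sym (toℕ-inject₁ i)))
        J≡1+i : J ≡ fsuc i
        J≡1+i = toℕ-injective (trans toℕ-J (cong suc toℕ-I))
        asc′ : w ⟨$⟩ʳ I Fin.< w ⟨$⟩ʳ J
        asc′ = subst₂ (λ x y → w ⟨$⟩ʳ x Fin.< w ⟨$⟩ʳ y) (sym I≡i) (sym J≡1+i) asc
        ws⊆v : us w ⊆Inv v
        ws⊆v a b a<b ba with (w ⟨$⟩ˡ b ≟ J) ×-dec (w ⟨$⟩ˡ a ≟ I)
        ... | no ¬JI = w⊆v a b a<b (Before-·s⁻ w ba ¬JI)
        ... | yes (w⁻¹b≡J , w⁻¹a≡I) = subst₂ (Before v)
          (trans (cong (w ⟨$⟩ʳ_) (sym (trans w⁻¹b≡J J≡1+i))) (inverseʳ w))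
          (trans (cong (w ⟨$⟩ʳ_) (sym (trans w⁻¹a≡I I≡i))) (inverseʳ w)) inverted

    -- each step raises ℓ, which is bounded, so the fuel never runs out
    climb : ∀ fuel w → length (allPairs (suc m)) ≤ fuel + ℓ w → w ⊆Inv v → w ≤R v
    climb fuel w bound w⊆v with any? (invertedAscent? w)
    ... | no none = w , ε , no-inverted-ascent⇒≈ w w⊆v (λ i inv → none (i , inv))
    ... | yes (i , inv) = continue fuel bound (climb-step w i w⊆v inv)
      where
        continue : ∀ fuel → length (allPairs (suc m)) ≤ fuel + ℓ w →
                   (Σ (Perm (suc m)) λ w′ → w ⋖R w′ × w′ ⊆Inv v) → w ≤R v
        continue zero bound (w′ , (_ , _ , _ , ℓw′≡1+ℓw) , _) =
          contradiction (ℕ.≤-trans (subst (_≤ length (allPairs (suc m))) ℓw′≡1+ℓw (ℓ-bounded w′)) bound)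
                        (ℕ.<-irrefl refl)
        continue (suc fuel) bound (w′ , w⋖w′@(_ , _ , _ , ℓw′≡1+ℓw) , w′⊆v) =
          let (z , w′⋖*z , z≈v) = climb fuel w′ bound′ w′⊆v in z , w⋖w′ ◅ w′⋖*z , z≈v
          where
            bound′ : length (allPairs (suc m)) ≤ fuel + ℓ w′
            bound′ = subst (length (allPairs (suc m)) ≤_)
                       (trans (sym (ℕ.+-suc fuel (ℓ w))) (cong (fuel +_) (sym ℓw′≡1+ℓw))) bound

≤R-trans : ∀ {m} {x y z : Perm m} → x ≤R y → y ≤R z → x ≤R z
≤R-trans {x = x} {y} {z} x≤y y≤z =
  ⊆Inv⇒≤R {u = x} {z} (⊆Inv-trans {u = x} {y} {z} (≤R⇒⊆Inv {u = x} {y} x≤y) (≤R⇒⊆Inv {u = y} {z} y≤z))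

injective⇒surjective : ∀ {m} (f : Fin m → Fin m) → Injective _≡_ _≡_ f → ∀ j → ∃ λ a → f a ≡ j
injective⇒surjective {suc k} f f-inj j with any? (λ a → f a ≟ j)
... | yes hit = hit
... | no miss = contradiction (λ {x} {y} → g-injective {x} {y}) (<⇒notInjective (ℕ.n<1+n k))
  where
    j≢f : ∀ a → j ≢ f a
    j≢f a j≡fa = miss (a , sym j≡fa)
    g : Fin (suc k) → Fin k
    g a = punchOut (j≢f a)
    g-injective : Injective _≡_ _≡_ g
    g-injective e = f-inj (punchOut-injective (j≢f _) (j≢f _) e)

record StrictTotal {m} (R : Fin m → Fin m → Set) : Set where
  field
    decide : ∀ a b → Dec (R a b)
    irreflexive : ∀ a → ¬ R a a
    transitive : ∀ {a b c} → R a b → R b c → R a c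
    total : ∀ {a b} → a ≢ b → R a b ⊎ R b a

-- The permutation listing Fin m in increasing R-order: the position of a is the number of R-predecessors of a.
module PermutationOf {m} {R : Fin m → Fin m → Set} (S : StrictTotal R) where
  open StrictTotal S

  rank : Fin m → ℕ
  rank a = sum (λ b → 𝕀 (decide b a))

  rank<m : ∀ a → rank a < m
  rank<m a = subst (rank a <_) (sum-const-1 m) (sum-mono-< (λ b → 𝕀≤1 (decide b a)) a 𝕀[aRa]<1)
    where
      𝕀[aRa]<1 : 𝕀 (decide a a) < 1
      𝕀[aRa]<1 = subst (_< 1) (sym (𝕀-no (decide a a) (irreflexive a))) (s≤s z≤n)

  rank-mono : ∀ {a b} → R a b → rank a < rank b
  rank-mono {a} {b} aRb = sum-mono-< pointwise a strict
    where
      pointwise : ∀ c → 𝕀 (decide c a) ≤ 𝕀 (decide c b)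
      pointwise c with decide c a | decide c b
      ... | yes cRa | no ¬cRb = contradiction (transitive cRa aRb) ¬cRb
      ... | yes _   | yes _   = ℕ.≤-refl
      ... | no _    | _       = z≤n
      strict : 𝕀 (decide a a) < 𝕀 (decide a b)
      strict rewrite 𝕀-no (decide a a) (irreflexive a) | 𝕀-yes (decide a b) aRb = s≤s z≤n

  position : Fin m → Fin m
  position a = fromℕ< (rank<m a)

  position-mono : ∀ {a b} → R a b → position a Fin.< position b
  position-mono {a} {b} aRb = subst₂ _<_ (sym (toℕ-fromℕ< _)) (sym (toℕ-fromℕ< _)) (rank-mono aRb)

  position-injective : Injective _≡_ _≡_ position
  position-injective {a} {b} eq with a ≟ b
  ... | yes a≡b = a≡b
  ... | no a≢b with total a≢b
  ...   | inj₁ aRb = contradiction eq (λ e → <-irrefl e (position-mono aRb))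
  ...   | inj₂ bRa = contradiction (sym eq) (λ e → <-irrefl e (position-mono bRa))

  σ : Perm m
  σ = permutation (proj₁ ∘ onto) position (λ a → position-injective (proj₂ (onto (position a)))) (proj₂ ∘ onto)
    where onto = injective⇒surjective position position-injective

  R⇒Before : ∀ {a b} → R a b → Before σ a b
  R⇒Before = position-mono

  Before⇒R : ∀ {a b} → Before σ a b → R a b
  Before⇒R {a} {b} ab with a ≟ b
  ... | yes refl = contradiction ab (<-irrefl refl)
  ... | no a≢b with total a≢b
  ...   | inj₁ aRb = aRb
  ...   | inj₂ bRa = contradiction (position-mono bRa) (<-asym ab)

Before-strictTotal : ∀ {k m} (σ : Perm m) (f : Fin k → Fin m) → Injective _≡_ _≡_ f →
  StrictTotal (λ a b → Before σ (f a) (f b))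
Before-strictTotal σ f f-injective = record
  { decide = λ a b → σ ⟨$⟩ˡ f a Fin.<? σ ⟨$⟩ˡ f b
  ; irreflexive = λ a → <-irrefl refl
  ; transitive = <-trans
  ; total = λ a≢b → Before-total σ (λ fa≡fb → a≢b (f-injective fa≡fb))
  }

-- The lattice of inversion sets

infixl 30 _ᶜ

_ᶜ : ∀ {n} → Perm n → Perm n
u ᶜ = reverse ∘ₚ u

Before-ᶜ⁺ : ∀ {n} (u : Perm n) {a b} → Before u b a → Before (u ᶜ) a b
Before-ᶜ⁺ u ba = opposite-< ba

Before-ᶜ⁻ : ∀ {n} (u : Perm n) {a b} → Before (u ᶜ) a b → Before u b a
Before-ᶜ⁻ u {a} {b} ab =
  subst₂ Fin._<_ (opposite-involutive (u ⟨$⟩ˡ b)) (opposite-involutive (u ⟨$⟩ˡ a)) (opposite-< ab)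

ᶜ-antitone : ∀ {n} {u v : Perm n} → u ⊆Inv v → v ᶜ ⊆Inv u ᶜ
ᶜ-antitone {u = u} {v} u⊆v a b a<b ba with Before-total u (<⇒≢ a<b)
... | inj₁ ab = Before-ᶜ⁺ u ab
... | inj₂ ba′ = contradiction (u⊆v a b a<b ba′) (<-asym (Before-ᶜ⁻ v ba))

ᶜ-involutive⁺ : ∀ {n} (u : Perm n) → u ⊆Inv u ᶜ ᶜ
ᶜ-involutive⁺ u a b _ ba = Before-ᶜ⁺ (u ᶜ) (Before-ᶜ⁺ u ba)

ᶜ-involutive⁻ : ∀ {n} (u : Perm n) → u ᶜ ᶜ ⊆Inv u
ᶜ-involutive⁻ u a b _ ba = Before-ᶜ⁻ u (Before-ᶜ⁻ (u ᶜ) ba)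

id-least : ∀ {n} (u : Perm n) → id ⊆Inv u
id-least u a b a<b b<a = contradiction b<a (<-asym a<b)

idᶜ-greatest : ∀ {n} (u : Perm n) → u ⊆Inv id ᶜ
idᶜ-greatest u a b a<b _ = Before-ᶜ⁺ id a<b

module Join {m} (x y : Perm m) where

  Inverted : Fin m → Fin m → Set
  Inverted a b = Before x b a ⊎ Before y b a

  inverted? : ∀ a b → Dec (Inverted a b)
  inverted? a b = (x ⟨$⟩ˡ b Fin.<? x ⟨$⟩ˡ a) ⊎-dec (y ⟨$⟩ˡ b Fin.<? y ⟨$⟩ˡ a)

  Chain : ℕ → Fin m → Fin m → Set
  Chain zero    a c = ⊥
  Chain (suc k) a c = (a Fin.< c × Inverted a c) ⊎ (∃ λ b → a Fin.< b × Inverted a b × Chain k b c)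

  chain? : ∀ k a c → Dec (Chain k a c)
  chain? zero    a c = no λ ()
  chain? (suc k) a c = ((a Fin.<? c) ×-dec inverted? a c)
                       ⊎-dec any? (λ b → (a Fin.<? b) ×-dec (inverted? a b ×-dec chain? k b c))

  chain-weaken : ∀ {k l} → k ≤ l → ∀ {a c} → Chain k a c → Chain l a c
  chain-weaken {suc k} {suc l} _   (inj₁ step) = inj₁ step
  chain-weaken {suc k} {suc l} k≤l (inj₂ (b , a<b , ab , bc)) = inj₂ (b , a<b , ab , chain-weaken (ℕ.s≤s⁻¹ k≤l) bc)

  chain-< : ∀ k {a c} → Chain k a c → a Fin.< c
  chain-< (suc k) (inj₁ (a<c , _)) = a<c
  chain-< (suc k) (inj₂ (b , a<b , _ , bc)) = <-trans a<b (chain-< k bc)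

  chain-shorten : ∀ k {a c} → Chain k a c → Chain (m ∸ toℕ a) a c
  chain-shorten (suc k) {a} {c} (inj₁ step) =
    subst (λ l → Chain l a c) (sym (ℕ.+-∸-assoc 1 (toℕ<n a))) (inj₁ step)
  chain-shorten (suc k) {a} (inj₂ (b , a<b , ab , bc)) =
    chain-weaken (subst (suc (m ∸ toℕ b) ≤_) (sym (ℕ.+-∸-assoc 1 (toℕ<n a))) (s≤s (ℕ.∸-monoʳ-≤ m a<b)))
                 (inj₂ (b , a<b , ab , chain-shorten k bc))

  -- Chains increase, so m steps suffice: this is the (decidable) transitive closure of Inverted.
  Closure : Fin m → Fin m → Set
  Closure = Chain m

  chain⇒closure : ∀ k {a c} → Chain k a c → Closure a c
  chain⇒closure k {a} ac = chain-weaken (ℕ.m∸n≤m m (toℕ a)) (chain-shorten k ac)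

  chain-++ : ∀ k l {a b c} → Chain k a b → Chain l b c → Chain (k + l) a c
  chain-++ (suc k) l {b = b} (inj₁ (a<b , ab)) bc = inj₂ (b , a<b , ab , chain-weaken (ℕ.m≤n+m l k) bc)
  chain-++ (suc k) l (inj₂ (d , a<d , ad , db)) bc = inj₂ (d , a<d , ad , chain-++ k l db bc)

  closure-trans : ∀ {a b c} → Closure a b → Closure b c → Closure a c
  closure-trans ab bc = chain⇒closure _ (chain-++ m m ab bc)

  inverted⇒closure : ∀ {a b} → a Fin.< b → Inverted a b → Closure a b
  inverted⇒closure a<b ab = chain⇒closure 1 (inj₁ (a<b , ab))

  closure-cons : ∀ {a b c} → a Fin.< b → Inverted a b → Closure b c → Closure a c
  closure-cons {b = b} a<b ab bc = chain⇒closure (suc m) (inj₂ (b , a<b , ab , bc))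

  inverted-split : ∀ {a b c} → a Fin.< b → b Fin.< c → Inverted a c → Inverted a b ⊎ Inverted b c
  inverted-split {a} {b} a<b _ (inj₁ ca) with Before-total x {b} {a} (λ b≡a → <⇒≢ a<b (sym b≡a))
  ... | inj₁ ba = inj₁ (inj₁ ba)
  ... | inj₂ ab = inj₂ (inj₁ (<-trans ca ab))
  inverted-split {a} {b} a<b _ (inj₂ ca) with Before-total y {b} {a} (λ b≡a → <⇒≢ a<b (sym b≡a))
  ... | inj₁ ba = inj₁ (inj₂ ba)
  ... | inj₂ ab = inj₂ (inj₂ (<-trans ca ab))

  chain-split : ∀ k {a b c} → a Fin.< b → b Fin.< c → Chain k a c → Closure a b ⊎ Closure b c
  chain-split (suc k) a<b b<c (inj₁ (_ , ac)) with inverted-split a<b b<c ac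
  ... | inj₁ ab = inj₁ (inverted⇒closure a<b ab)
  ... | inj₂ bc = inj₂ (inverted⇒closure b<c bc)
  chain-split (suc k) {b = b} a<b b<c (inj₂ (d , a<d , ad , dc)) with <-cmp b d
  ... | tri< b<d _ _ with inverted-split a<b b<d ad
  ...   | inj₁ ab = inj₁ (inverted⇒closure a<b ab)
  ...   | inj₂ bd = inj₂ (closure-cons b<d bd (chain⇒closure k dc))
  chain-split (suc k) a<b b<c (inj₂ (d , a<d , ad , dc)) | tri≈ _ refl _ = inj₁ (inverted⇒closure a<d ad)
  chain-split (suc k) a<b b<c (inj₂ (d , a<d , ad , dc)) | tri> _ _ d<b with chain-split k d<b b<c dc
  ... | inj₁ db = inj₁ (closure-cons a<d ad db)
  ... | inj₂ bc = inj₂ bc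

  closure-split : ∀ {a b c} → a Fin.< b → b Fin.< c → Closure a c → Closure a b ⊎ Closure b c
  closure-split = chain-split m

  -- The join inverts a pair of values exactly when the pair is in the closure.
  Precedes : Fin m → Fin m → Set
  Precedes a b = (a Fin.< b × ¬ Closure a b) ⊎ (b Fin.< a × Closure b a)

  precedes-trans : ∀ {a b c} → Precedes a b → Precedes b c → Precedes a c
  precedes-trans (inj₁ (a<b , ¬ab)) (inj₁ (b<c , ¬bc)) =
    inj₁ (<-trans a<b b<c , λ ac → [ ¬ab , ¬bc ]′ (closure-split a<b b<c ac))
  precedes-trans {a} {b} {c} (inj₁ (a<b , ¬ab)) (inj₂ (c<b , cb)) with <-cmp a c
  ... | tri< a<c _ _ = inj₁ (a<c , λ ac → ¬ab (closure-trans ac cb))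
  ... | tri≈ _ refl _ = contradiction cb ¬ab
  ... | tri> _ _ c<a with closure-split c<a a<b cb
  ...   | inj₁ ca = inj₂ (c<a , ca)
  ...   | inj₂ ab = contradiction ab ¬ab
  precedes-trans {a} {b} {c} (inj₂ (b<a , ba)) (inj₁ (b<c , ¬bc)) with <-cmp a c
  ... | tri< a<c _ _ = inj₁ (a<c , λ ac → ¬bc (closure-trans ba ac))
  ... | tri≈ _ refl _ = contradiction ba ¬bc
  ... | tri> _ _ c<a with closure-split b<c c<a ba
  ...   | inj₁ bc = contradiction bc ¬bc
  ...   | inj₂ ca = inj₂ (c<a , ca)
  precedes-trans (inj₂ (b<a , ba)) (inj₂ (c<b , cb)) = inj₂ (<-trans c<b b<a , closure-trans cb ba)

  precedes-total : ∀ {a b} → a ≢ b → Precedes a b ⊎ Precedes b a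
  precedes-total {a} {b} a≢b with <-cmp a b
  ... | tri≈ _ a≡b _ = contradiction a≡b a≢b
  ... | tri< a<b _ _ with chain? m a b
  ...   | yes ab = inj₂ (inj₂ (a<b , ab))
  ...   | no ¬ab = inj₁ (inj₁ (a<b , ¬ab))
  precedes-total {a} {b} a≢b | tri> _ _ b<a with chain? m b a
  ...   | yes ba = inj₁ (inj₂ (b<a , ba))
  ...   | no ¬ba = inj₂ (inj₁ (b<a , ¬ba))

  precedes-strictTotal : StrictTotal Precedes
  precedes-strictTotal = record
    { decide = λ a b → ((a Fin.<? b) ×-dec ¬? (chain? m a b)) ⊎-dec ((b Fin.<? a) ×-dec chain? m b a)
    ; irreflexive = λ { a (inj₁ (a<a , _)) → <-irrefl refl a<a ; a (inj₂ (a<a , _)) → <-irrefl refl a<a }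
    ; transitive = precedes-trans
    ; total = precedes-total
    }

  open PermutationOf precedes-strictTotal using (R⇒Before; Before⇒R)

  join : Perm m
  join = PermutationOf.σ precedes-strictTotal

  x⊆join : x ⊆Inv join
  x⊆join a b a<b ba = R⇒Before (inj₂ (a<b , inverted⇒closure a<b (inj₁ ba)))

  y⊆join : y ⊆Inv join
  y⊆join a b a<b ba = R⇒Before (inj₂ (a<b , inverted⇒closure a<b (inj₂ ba)))

  join-least : ∀ z → x ⊆Inv z → y ⊆Inv z → join ⊆Inv z
  join-least z x⊆z y⊆z a b a<b ba with Before⇒R ba
  ... | inj₁ (b<a , _) = contradiction b<a (<-asym a<b)
  ... | inj₂ (_ , ab) = closure⇒inverted m ab
    where
      closure⇒inverted : ∀ k {a c} → Chain k a c → Before z c a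
      closure⇒inverted (suc k) (inj₁ (a<c , inj₁ ca)) = x⊆z _ _ a<c ca
      closure⇒inverted (suc k) (inj₁ (a<c , inj₂ ca)) = y⊆z _ _ a<c ca
      closure⇒inverted (suc k) (inj₂ (d , a<d , inj₁ da , dc)) = <-trans (closure⇒inverted k dc) (x⊆z _ _ a<d da)
      closure⇒inverted (suc k) (inj₂ (d , a<d , inj₂ da , dc)) = <-trans (closure⇒inverted k dc) (y⊆z _ _ a<d da)

⊆Inv-complementedLattice : ∀ m → IsComplementedLattice (Perm m) _⊆Inv_
⊆Inv-complementedLattice m = id , id ᶜ , id-least , idᶜ-greatest , meet , join′ , complemented
  where
    open Join using (join; x⊆join; y⊆join; join-least)
    join′ : ∀ x y → Σ (Perm m) λ w → x ⊆Inv w × y ⊆Inv w × (∀ z → x ⊆Inv z → y ⊆Inv z → w ⊆Inv z)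
    join′ x y = join x y , x⊆join x y , y⊆join x y , join-least x y
    meet : ∀ x y → Σ (Perm m) λ w → w ⊆Inv x × w ⊆Inv y × (∀ z → z ⊆Inv x → z ⊆Inv y → z ⊆Inv w)
    meet x y = w ᶜ
             , ⊆Inv-trans {u = w ᶜ} {x ᶜ ᶜ} {x} (ᶜ-antitone {u = x ᶜ} {w} (x⊆join (x ᶜ) (y ᶜ))) (ᶜ-involutive⁻ x)
             , ⊆Inv-trans {u = w ᶜ} {y ᶜ ᶜ} {y} (ᶜ-antitone {u = y ᶜ} {w} (y⊆join (x ᶜ) (y ᶜ))) (ᶜ-involutive⁻ y)
             , λ z z⊆x z⊆y → ⊆Inv-trans {u = z} {z ᶜ ᶜ} {w ᶜ} (ᶜ-involutive⁺ z)
                 (ᶜ-antitone {u = w} {z ᶜ} (join-least (x ᶜ) (y ᶜ) (z ᶜ)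
                   (ᶜ-antitone {u = z} {x} z⊆x) (ᶜ-antitone {u = z} {y} z⊆y)))
      where w = join (x ᶜ) (y ᶜ)
    complemented : ∀ x → Σ (Perm m) λ x′ → (∀ z → z ⊆Inv x → z ⊆Inv x′ → z ⊆Inv id)
                                         × (∀ z → x ⊆Inv z → x′ ⊆Inv z → id ᶜ ⊆Inv z)
    complemented x = x ᶜ
                   , (λ z z⊆x z⊆x′ a b a<b ba →
                        contradiction (z⊆x a b a<b ba) (<-asym (Before-ᶜ⁻ x (z⊆x′ a b a<b ba))))
                   , λ z x⊆z x′⊆z a b a<b _ → [ x⊆z a b a<b , (λ ab → x′⊆z a b a<b (Before-ᶜ⁺ x ab)) ]′
                                                  (swap (Before-total x (<⇒≢ a<b)))

≤R-complementedLattice : ∀ m → IsComplementedLattice (Perm m) _≤R_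
≤R-complementedLattice m =
  IsComplementedLattice-⇔ (λ {x} {y} → ⊆Inv⇒≤R {u = x} {y}) (λ {x} {y} → ≤R⇒⊆Inv {u = x} {y})
                          (⊆Inv-complementedLattice m)

double : ℕ → ℕ
double zero    = zero
double (suc k) = suc (suc (double k))

⌊double/2⌋ : ∀ k → ⌊ double k /2⌋ ≡ k
⌊double/2⌋ zero    = refl
⌊double/2⌋ (suc k) = cong suc (⌊double/2⌋ k)

⌊1+double/2⌋ : ∀ k → ⌊ suc (double k) /2⌋ ≡ k
⌊1+double/2⌋ zero    = refl
⌊1+double/2⌋ (suc k) = cong suc (⌊1+double/2⌋ k)

isEven-double : ∀ k → isEven (double k) ≡ true
isEven-double zero    = refl
isEven-double (suc k) = isEven-double k

isEven-1+double : ∀ k → isEven (suc (double k)) ≡ false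
isEven-1+double zero    = refl
isEven-1+double (suc k) = isEven-1+double k

double-⌊/2⌋ : ∀ a → double ⌊ a /2⌋ ≡ a ⊎ suc (double ⌊ a /2⌋) ≡ a
double-⌊/2⌋ zero          = inj₁ refl
double-⌊/2⌋ (suc zero)    = inj₂ refl
double-⌊/2⌋ (suc (suc a)) with double-⌊/2⌋ a
... | inj₁ eq = inj₁ (cong (suc ∘ suc) eq)
... | inj₂ eq = inj₂ (cong (suc ∘ suc) eq)

double-mono-< : ∀ {k l} → k < l → double k < double l
double-mono-< {zero}  {suc l} _         = s≤s z≤n
double-mono-< {suc k} {suc l} (s≤s k<l) = s≤s (s≤s (double-mono-< k<l))

double<⌈/2⌉ : ∀ {n k} → k < ⌈ n /2⌉ → double k < n
double<⌈/2⌉ {suc zero}    {zero}  _         = s≤s z≤n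
double<⌈/2⌉ {suc zero}    {suc k} (s≤s ())
double<⌈/2⌉ {suc (suc n)} {zero}  _         = s≤s z≤n
double<⌈/2⌉ {suc (suc n)} {suc k} (s≤s k<) = s≤s (s≤s (double<⌈/2⌉ {n} k<))

1+double<⌊/2⌋ : ∀ {n k} → k < ⌊ n /2⌋ → suc (double k) < n
1+double<⌊/2⌋ {suc (suc n)} {zero}  _         = s≤s (s≤s z≤n)
1+double<⌊/2⌋ {suc (suc n)} {suc k} (s≤s k<) = s≤s (s≤s (1+double<⌊/2⌋ {n} k<))

1+double<⇒<⌊/2⌋ : ∀ {n k} → suc (double k) < n → k < ⌊ n /2⌋
1+double<⇒<⌊/2⌋ {n} {k} lt = subst (_≤ ⌊ n /2⌋) (⌊double/2⌋ (suc k)) (ℕ.⌊n/2⌋-mono lt)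

⌊/2⌋<⌈/2⌉ : ∀ {n a} → a < n → ⌊ a /2⌋ < ⌈ n /2⌉
⌊/2⌋<⌈/2⌉ {n} {a} a<n = ℕ.⌊n/2⌋-mono {suc (suc a)} {suc n} (s≤s a<n)

<⇒≤∸1 : ∀ {x n} → x < n → x ≤ n ∸ 1
<⇒≤∸1 (s≤s x≤n-1) = x≤n-1

≤∸1⇒< : ∀ {i n} → 1 ≤ i → i ≤ n ∸ 1 → i < n
≤∸1⇒< {n = suc _} _         i≤n-1 = s≤s i≤n-1
≤∸1⇒< {n = zero}  (s≤s z≤n) ()

-- Values 0 … n-1 are grouped in blocks {2k, 2k+1}; all ⌈n/2⌉ blocks have an even element,
-- only the first ⌊n/2⌋ an odd one.

module Blocks (n : ℕ) where

  c h : ℕ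
  c = ⌈ n /2⌉
  h = ⌊ n /2⌋

  block : Fin n → Fin c
  block a = fromℕ< (⌊/2⌋<⌈/2⌉ (toℕ<n a))

  even : Fin c → Fin n
  even k = fromℕ< (double<⌈/2⌉ {n} (toℕ<n k))

  odd : Fin h → Fin n
  odd j = fromℕ< (1+double<⌊/2⌋ {n} (toℕ<n j))

  pairBlock : Fin h → Fin c
  pairBlock j = inject≤ j (ℕ.⌊n/2⌋≤⌈n/2⌉ n)

  partner : Fin h → Fin n
  partner j = even (pairBlock j)

  toℕ-block : ∀ a → toℕ (block a) ≡ ⌊ toℕ a /2⌋
  toℕ-block a = toℕ-fromℕ< _

  toℕ-even : ∀ k → toℕ (even k) ≡ double (toℕ k)
  toℕ-even k = toℕ-fromℕ< _

  toℕ-odd : ∀ j → toℕ (odd j) ≡ suc (double (toℕ j))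
  toℕ-odd j = toℕ-fromℕ< _

  toℕ-partner : ∀ j → toℕ (partner j) ≡ double (toℕ j)
  toℕ-partner j = trans (toℕ-even (pairBlock j)) (cong double (toℕ-inject≤ j _))

  block-even : ∀ k → block (even k) ≡ k
  block-even k = toℕ-injective (trans (toℕ-block (even k)) (trans (cong ⌊_/2⌋ (toℕ-even k)) (⌊double/2⌋ (toℕ k))))

  block-odd : ∀ j → block (odd j) ≡ pairBlock j
  block-odd j = toℕ-injective (trans (toℕ-block (odd j))
    (trans (cong ⌊_/2⌋ (toℕ-odd j)) (trans (⌊1+double/2⌋ (toℕ j)) (sym (toℕ-inject≤ j _)))))

  block-partner : ∀ j → block (partner j) ≡ pairBlock j
  block-partner j = block-even (pairBlock j)

  even-injective : ∀ {k l} → even k ≡ even l → k ≡ l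
  even-injective {k} {l} eq = trans (sym (block-even k)) (trans (cong block eq) (block-even l))

  pairBlock-injective : ∀ {i j} → pairBlock i ≡ pairBlock j → i ≡ j
  pairBlock-injective = inject≤-injective _ _ _ _

  partner<odd : ∀ j → partner j Fin.< odd j
  partner<odd j = subst₂ _<_ (sym (toℕ-partner j)) (sym (toℕ-odd j)) (ℕ.n<1+n _)

  odd≡1+partner : ∀ j → toℕ (odd j) ≡ suc (toℕ (partner j))
  odd≡1+partner j = trans (toℕ-odd j) (cong suc (sym (toℕ-partner j)))

  even-or-odd : ∀ a → even (block a) ≡ a ⊎ ∃ λ j → odd j ≡ a
  even-or-odd a with double-⌊/2⌋ (toℕ a)
  ... | inj₁ eq = inj₁ (toℕ-injective (trans (toℕ-even (block a)) (trans (cong double (toℕ-block a)) eq)))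
  ... | inj₂ eq = inj₂ (fromℕ< j<h ,
                       toℕ-injective (trans (toℕ-odd _) (trans (cong (suc ∘ double) (toℕ-fromℕ< j<h)) eq)))
    where
      j<h : ⌊ toℕ a /2⌋ < h
      j<h = 1+double<⇒<⌊/2⌋ {n} (subst (_< n) (sym eq) (toℕ<n a))

  same-block : ∀ {a b} → block a ≡ block b → a ≢ b →
    ∃ λ j → (a ≡ partner j × b ≡ odd j) ⊎ (a ≡ odd j × b ≡ partner j)
  same-block {a} {b} ab a≢b with even-or-odd a | even-or-odd b
  ... | inj₁ ea | inj₁ eb = contradiction (trans (sym ea) (trans (cong even ab) eb)) a≢b
  ... | inj₁ ea | inj₂ (j , refl) = j , inj₁ (trans (sym ea) (cong even (trans ab (block-odd j))) , refl)
  ... | inj₂ (j , refl) | inj₁ eb = j , inj₂ (refl , trans (sym eb) (cong even (trans (sym ab) (block-odd j))))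
  ... | inj₂ (i , refl) | inj₂ (j , refl) =
        contradiction (cong odd (pairBlock-injective (trans (sym (block-odd i)) (trans ab (block-odd j))))) a≢b

  position : Perm n → Fin n → ℕ
  position σ a = toℕ (σ ⟨$⟩ˡ a)

  PairsAdjacent : Perm n → Set
  PairsAdjacent σ = ∀ j → ∣ position σ (partner j) - position σ (odd j) ∣ ≤ 1

  -- pos takes a 1-indexed value and returns a 1-indexed position.
  pos-toℕ : ∀ σ a → pos σ (suc (toℕ a)) ≡ suc (position σ a)
  pos-toℕ σ a with suc (toℕ a) ℕ.≤? n
  ... | yes a<n = cong (suc ∘ toℕ ∘ (σ ⟨$⟩ˡ_)) (fromℕ<-toℕ a a<n)
  ... | no a≮n = contradiction (toℕ<n a) a≮n

  star-partner : ∀ j → star n (suc (toℕ (partner j))) ≡ suc (toℕ (odd j))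
  star-partner j rewrite toℕ-partner j | isEven-1+double (toℕ j)
                       | Equivalence.to T-≡ (ℕ.≤⇒≤ᵇ (subst (_< n) (toℕ-odd j) (toℕ<n (odd j))))
                       = sym (cong suc (toℕ-odd j))

  star-odd : ∀ j → star n (suc (toℕ (odd j))) ≡ suc (toℕ (partner j))
  star-odd j rewrite toℕ-odd j | isEven-double (toℕ j) = cong suc (sym (toℕ-partner j))

  IsWachs⇒PairsAdjacent : ∀ σ → IsWachs σ → PairsAdjacent σ
  IsWachs⇒PairsAdjacent σ wachs j = subst₂ (λ x y → ∣ x - y ∣ ≤ 1) (pos-toℕ σ (partner j))
    (trans (cong (pos σ) (star-partner j)) (pos-toℕ σ (odd j)))
    (wachs (suc (toℕ (partner j))) (s≤s z≤n) (<⇒≤∸1 (subst (_< n) (odd≡1+partner j) (toℕ<n (odd j)))))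

  PairsAdjacent⇒IsWachs : ∀ σ → PairsAdjacent σ → IsWachs σ
  PairsAdjacent⇒IsWachs σ adj (suc x) 1≤x+1 x+1≤n-1 = by-parity (double-⌊/2⌋ x)
    where
      Holds : ℕ → Set
      Holds v = ∣ pos σ (suc v) - pos σ (star n (suc v)) ∣ ≤ 1
      at-partner : ∀ j → Holds (toℕ (partner j))
      at-partner j = subst₂ (λ x y → ∣ x - y ∣ ≤ 1) (sym (pos-toℕ σ (partner j)))
        (sym (trans (cong (pos σ) (star-partner j)) (pos-toℕ σ (odd j)))) (adj j)
      at-odd : ∀ j → Holds (toℕ (odd j))
      at-odd j = subst₂ (λ x y → ∣ x - y ∣ ≤ 1) (sym (pos-toℕ σ (odd j)))
        (sym (trans (cong (pos σ) (star-odd j)) (pos-toℕ σ (partner j))))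
        (subst (_≤ 1) (ℕ.∣-∣-comm (position σ (partner j)) _) (adj j))
      x+1<n : suc x < n
      x+1<n = ≤∸1⇒< 1≤x+1 x+1≤n-1
      by-parity : double ⌊ x /2⌋ ≡ x ⊎ suc (double ⌊ x /2⌋) ≡ x → Holds x
      by-parity (inj₁ eq) = subst Holds (trans (toℕ-partner j) (trans (cong double (toℕ-fromℕ< _)) eq)) (at-partner j)
        where j = fromℕ< (1+double<⇒<⌊/2⌋ {n} (subst (λ v → suc v < n) (sym eq) x+1<n))
      by-parity (inj₂ eq) = subst Holds (trans (toℕ-odd j) (trans (cong (suc ∘ double) (toℕ-fromℕ< _)) eq)) (at-odd j)
        where j = fromℕ< (1+double<⇒<⌊/2⌋ {n} (subst (_< n) (sym eq) (ℕ.<-trans (ℕ.n<1+n x) x+1<n)))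

-- Wachs permutations as pairs (block order, flipped blocks)

∣-∣≤1⇒≤1+ : ∀ x y → ∣ x - y ∣ ≤ 1 → x ≤ suc y
∣-∣≤1⇒≤1+ zero    y       _ = z≤n
∣-∣≤1⇒≤1+ (suc x) zero    d = d
∣-∣≤1⇒≤1+ (suc x) (suc y) d = s≤s (∣-∣≤1⇒≤1+ x y d)

∣n-1+n∣≤1 : ∀ x → ∣ x - suc x ∣ ≤ 1
∣n-1+n∣≤1 zero    = s≤s z≤n
∣n-1+n∣≤1 (suc x) = ∣n-1+n∣≤1 x

∣-∣≤1⇒same-side : ∀ {x y z} → ∣ x - y ∣ ≤ 1 → z ≢ y → (x < z → y < z) × (z < x → z < y)
∣-∣≤1⇒same-side {x} {y} {z} d z≢y =
    (λ x<z → ℕ.≤∧≢⇒< (ℕ.≤-trans (∣-∣≤1⇒≤1+ y x (subst (_≤ 1) (ℕ.∣-∣-comm x y) d)) x<z) (λ y≡z → z≢y (sym y≡z)))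
  , (λ z<x → ℕ.≤∧≢⇒< (ℕ.≤-pred (ℕ.≤-trans z<x (∣-∣≤1⇒≤1+ x y d))) z≢y)

nothing-between⇒adjacent : ∀ {n} (σ : Perm n) {x y} → Before σ x y → (∀ z → ¬ (Before σ x z × Before σ z y)) →
  toℕ (σ ⟨$⟩ˡ y) ≡ suc (toℕ (σ ⟨$⟩ˡ x))
nothing-between⇒adjacent {n} σ {x} {y} x<y empty = ℕ.≤-antisym (ℕ.≮⇒≥ no-gap) x<y
  where
    no-gap : ¬ (suc (toℕ (σ ⟨$⟩ˡ x)) < toℕ (σ ⟨$⟩ˡ y))
    no-gap gap = empty z ( subst (toℕ (σ ⟨$⟩ˡ x) <_) (sym toℕ-σ⁻¹z) ℕ.≤-refl
                         , subst (_< toℕ (σ ⟨$⟩ˡ y)) (sym toℕ-σ⁻¹z) gap)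
      where
        k<n = ℕ.<-trans gap (toℕ<n (σ ⟨$⟩ˡ y))
        z = σ ⟨$⟩ʳ fromℕ< k<n
        toℕ-σ⁻¹z : toℕ (σ ⟨$⟩ˡ z) ≡ suc (toℕ (σ ⟨$⟩ˡ x))
        toℕ-σ⁻¹z = trans (cong toℕ (inverseˡ σ)) (toℕ-fromℕ< k<n)

≤P-trans : ∀ {m k} {x y z : Prod m k} → x ≤P y → y ≤P z → x ≤P z
≤P-trans {x = x} {y} {z} (x≤y , x⊆y) (y≤z , y⊆z) =
  ≤R-trans {x = proj₁ x} {proj₁ y} {proj₁ z} x≤y y≤z , λ i∈ → y⊆z (x⊆y i∈)

module WachsIso (n : ℕ) where
  open Blocks n
  open Equivalence using (to; from)

  module _ (σ : Perm n) (adj : PairsAdjacent σ) where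

    pair-same-side : ∀ j {z} → z ≢ partner j → z ≢ odd j →
      (Before σ (partner j) z ⇔ Before σ (odd j) z) × (Before σ z (partner j) ⇔ Before σ z (odd j))
    pair-same-side j {z} z≢p z≢o =
      let (p<z⇒o<z , z<p⇒z<o) = ∣-∣≤1⇒same-side (adj j) (position-≢ z≢o)
          (o<z⇒p<z , z<o⇒z<p) = ∣-∣≤1⇒same-side (subst (_≤ 1) (ℕ.∣-∣-comm (position σ (partner j)) _) (adj j))
                                                 (position-≢ z≢p)
      in mk⇔ p<z⇒o<z o<z⇒p<z , mk⇔ z<p⇒z<o z<o⇒z<p
      where
        position-≢ : ∀ {x y} → x ≢ y → position σ x ≢ position σ y
        position-≢ x≢y eq = x≢y (⟨$⟩ˡ-injective σ (toℕ-injective eq))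

    Before-even-block : ∀ {a z} → block z ≢ block a →
      (Before σ a z ⇔ Before σ (even (block a)) z) × (Before σ z a ⇔ Before σ z (even (block a)))
    Before-even-block {a} {z} z∉[a] with even-or-odd a
    ... | inj₁ a-even =
      subst (λ w → (Before σ w z ⇔ Before σ (even (block a)) z) × (Before σ z w ⇔ Before σ z (even (block a))))
            a-even (⇔-refl , ⇔-refl)
    ... | inj₂ (j , refl) = subst (λ w → (Before σ (odd j) z ⇔ Before σ w z) × (Before σ z (odd j) ⇔ Before σ z w))
                                  (cong even (sym (block-odd j)))
                                  (⇔-sym (proj₁ same) , ⇔-sym (proj₂ same))
      where
        same = pair-same-side j (λ z≡p → z∉[a] (trans (cong block z≡p) (trans (block-partner j) (sym (block-odd j)))))
                                (λ z≡o → z∉[a] (cong block z≡o))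

    Before-blocks : ∀ {a b} → block a ≢ block b → Before σ a b ⇔ Before σ (even (block a)) (even (block b))
    Before-blocks {a} {b} a∉[b] = ⇔-trans (proj₁ (Before-even-block (λ eq → a∉[b] (sym eq))))
                                          (proj₂ (Before-even-block (λ eq → a∉[b] (trans (sym (block-even (block a))) eq))))

  τ : Perm n → Perm c
  τ σ = PermutationOf.σ (Before-strictTotal σ even even-injective)

  Before-τ : ∀ σ {k l} → Before (τ σ) k l ⇔ Before σ (even k) (even l)
  Before-τ σ = mk⇔ Before⇒R R⇒Before
    where open PermutationOf (Before-strictTotal σ even even-injective)

  flips : Perm n → Subset h
  flips σ = Vec.tabulate (λ j → does (σ ⟨$⟩ˡ odd j Fin.<? σ ⟨$⟩ˡ partner j))

  ∈-flips : ∀ σ j → j ∈ flips σ ⇔ Before σ (odd j) (partner j)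
  ∈-flips σ j = mk⇔
    (λ j∈ → does⇒ (σ ⟨$⟩ˡ odd j Fin.<? σ ⟨$⟩ˡ partner j) (trans (sym (lookup∘tabulate flip j)) ([]=⇒lookup j∈)))
    (λ o<p → lookup⇒[]= j (flips σ) (trans (lookup∘tabulate flip j)
                                           (dec-true (σ ⟨$⟩ˡ odd j Fin.<? σ ⟨$⟩ˡ partner j) o<p)))
    where
      flip : Fin h → Bool
      flip j = does (σ ⟨$⟩ˡ odd j Fin.<? σ ⟨$⟩ˡ partner j)
      does⇒ : ∀ {P : Set} (P? : Dec P) → does P? ≡ true → P
      does⇒ (yes p) _ = p

  -- The inverse map: the blocks in the order t, each listed increasingly unless it is flipped by A.
  module Assemble (t : Perm c) (A : Subset h) where

    Flipped : Fin c → Set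
    Flipped k = ∃ λ j → pairBlock j ≡ k × j ∈ A

    flipped? : ∀ k → Dec (Flipped k)
    flipped? k = any? (λ j → (pairBlock j ≟ k) ×-dec (j ∈? A))

    Flipped-pairBlock : ∀ j → Flipped (pairBlock j) ⇔ j ∈ A
    Flipped-pairBlock j = mk⇔ (λ (i , i≡j , i∈A) → subst (_∈ A) (pairBlock-injective i≡j) i∈A) (λ j∈A → j , refl , j∈A)

    InBlock : Fin n → Fin n → Set
    InBlock a b = (a Fin.< b × ¬ Flipped (block a)) ⊎ (b Fin.< a × Flipped (block a))

    Order : Fin n → Fin n → Set
    Order a b = (block a ≢ block b × Before t (block a) (block b)) ⊎ (block a ≡ block b × InBlock a b)

    InBlock-irreflexive : ∀ a → ¬ InBlock a a
    InBlock-irreflexive a (inj₁ (a<a , _)) = <-irrefl refl a<a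
    InBlock-irreflexive a (inj₂ (a<a , _)) = <-irrefl refl a<a

    InBlock-trans : ∀ {a b c} → block a ≡ block b → InBlock a b → InBlock b c → InBlock a c
    InBlock-trans ab (inj₁ (a<b , ¬f)) (inj₁ (b<c , _)) = inj₁ (<-trans a<b b<c , ¬f)
    InBlock-trans ab (inj₁ (_ , ¬f)) (inj₂ (_ , f)) = contradiction (subst Flipped (sym ab) f) ¬f
    InBlock-trans ab (inj₂ (_ , f)) (inj₁ (_ , ¬f)) = contradiction (subst Flipped ab f) ¬f
    InBlock-trans ab (inj₂ (b<a , f)) (inj₂ (c<b , _)) = inj₂ (<-trans c<b b<a , f)

    InBlock-between : ∀ {x y z} → block x ≡ block z → InBlock x z → InBlock z y →
      (x Fin.< z × z Fin.< y) ⊎ (y Fin.< z × z Fin.< x)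
    InBlock-between xz (inj₁ (x<z , _)) (inj₁ (z<y , _)) = inj₁ (x<z , z<y)
    InBlock-between xz (inj₁ (_ , ¬f)) (inj₂ (_ , f)) = contradiction (subst Flipped (sym xz) f) ¬f
    InBlock-between xz (inj₂ (_ , f)) (inj₁ (_ , ¬f)) = contradiction (subst Flipped xz f) ¬f
    InBlock-between xz (inj₂ (z<x , _)) (inj₂ (y<z , _)) = inj₂ (y<z , z<x)

    order-trans : ∀ {a b c} → Order a b → Order b c → Order a c
    order-trans {a} {b} {c} (inj₁ (_ , ab)) (inj₁ (_ , bc)) =
      inj₁ ((λ a~c → <-asym ab (subst (λ k → Before t (block b) k) (sym a~c) bc)) , <-trans ab bc)
    order-trans (inj₁ (a≁b , ab)) (inj₂ (b~c , _)) =
      inj₁ ((λ a~c → a≁b (trans a~c (sym b~c))) , subst (Before t _) b~c ab)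
    order-trans (inj₂ (a~b , _)) (inj₁ (b≁c , bc)) =
      inj₁ ((λ a~c → b≁c (trans (sym a~b) a~c)) , subst (λ k → Before t k _) (sym a~b) bc)
    order-trans (inj₂ (a~b , ab)) (inj₂ (b~c , bc)) = inj₂ (trans a~b b~c , InBlock-trans a~b ab bc)

    order-total : ∀ {a b} → a ≢ b → Order a b ⊎ Order b a
    order-total {a} {b} a≢b with block a ≟ block b
    ... | no a≁b with Before-total t a≁b
    ...   | inj₁ ab = inj₁ (inj₁ (a≁b , ab))
    ...   | inj₂ ba = inj₂ (inj₁ ((λ b~a → a≁b (sym b~a)) , ba))
    order-total {a} {b} a≢b | yes a~b with <-cmp a b | flipped? (block a)
    ... | tri≈ _ a≡b _ | _ = contradiction a≡b a≢b
    ... | tri< a<b _ _ | no ¬f = inj₁ (inj₂ (a~b , inj₁ (a<b , ¬f)))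
    ... | tri< a<b _ _ | yes f = inj₂ (inj₂ (sym a~b , inj₂ (a<b , subst Flipped a~b f)))
    ... | tri> _ _ b<a | no ¬f = inj₂ (inj₂ (sym a~b , inj₁ (b<a , λ f → ¬f (subst Flipped (sym a~b) f))))
    ... | tri> _ _ b<a | yes f = inj₁ (inj₂ (a~b , inj₂ (b<a , f)))

    order-strictTotal : StrictTotal Order
    order-strictTotal = record
      { decide = λ a b → (¬? (block a ≟ block b) ×-dec (t ⟨$⟩ˡ block a Fin.<? t ⟨$⟩ˡ block b))
                         ⊎-dec ((block a ≟ block b) ×-dec (((a Fin.<? b) ×-dec ¬? (flipped? (block a)))
                                                          ⊎-dec ((b Fin.<? a) ×-dec flipped? (block a))))
      ; irreflexive = λ { a (inj₁ (a≁a , _)) → a≁a refl ; a (inj₂ (_ , aa)) → InBlock-irreflexive a aa }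
      ; transitive = order-trans
      ; total = order-total
      }

    ρ : Perm n
    ρ = PermutationOf.σ order-strictTotal

    Before-ρ : ∀ {a b} → Before ρ a b ⇔ Order a b
    Before-ρ = mk⇔ Before⇒R R⇒Before
      where open PermutationOf order-strictTotal

    Order-between : ∀ {x y z} → block x ≡ block y → Order x z → Order z y →
      block x ≡ block z × InBlock x z × InBlock z y
    Order-between {x} x~y (inj₁ (_ , xz)) (inj₁ (_ , zy)) = contradiction (subst (Before t _) (sym x~y) zy) (<-asym xz)
    Order-between x~y (inj₁ (x≁z , _)) (inj₂ (z~y , _)) = contradiction (trans x~y (sym z~y)) x≁z
    Order-between x~y (inj₂ (x~z , _)) (inj₁ (z≁y , _)) = contradiction (trans (sym x~z) x~y) z≁y
    Order-between x~y (inj₂ (x~z , xz)) (inj₂ (_ , zy)) = x~z , xz , zy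

    partner-odd-consecutive : ∀ j z → (partner j Fin.< z × z Fin.< odd j) ⊎ (odd j Fin.< z × z Fin.< partner j) → ⊥
    partner-odd-consecutive j z (inj₁ (p<z , z<o)) =
      ℕ.<⇒≱ p<z (ℕ.≤-pred (subst (suc (toℕ z) ≤_) (odd≡1+partner j) z<o))
    partner-odd-consecutive j z (inj₂ (o<z , z<p)) = <-asym (<-trans o<z z<p) (partner<odd j)

    pair-nothing-between : ∀ j {x y} → (x ≡ partner j × y ≡ odd j) ⊎ (x ≡ odd j × y ≡ partner j) →
      ∀ z → ¬ (Order x z × Order z y)
    pair-nothing-between j (inj₁ (refl , refl)) z (xz , zy) =
      let (x~z , ixz , izy) = Order-between (trans (block-partner j) (sym (block-odd j))) xz zy
      in partner-odd-consecutive j z (InBlock-between x~z ixz izy)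
    pair-nothing-between j (inj₂ (refl , refl)) z (xz , zy) =
      let (x~z , ixz , izy) = Order-between (trans (block-odd j) (sym (block-partner j))) xz zy
      in partner-odd-consecutive j z (swap (InBlock-between x~z ixz izy))

    pair-adjacent : ∀ j {x y} → (x ≡ partner j × y ≡ odd j) ⊎ (x ≡ odd j × y ≡ partner j) →
      Before ρ x y → position ρ y ≡ suc (position ρ x)
    pair-adjacent j xy x<y = nothing-between⇒adjacent ρ x<y
      (λ z (xz , zy) → pair-nothing-between j xy z (to Before-ρ xz , to Before-ρ zy))

    ρ-pairsAdjacent : PairsAdjacent ρ
    ρ-pairsAdjacent j = by-order (Before-total ρ (<⇒≢ (partner<odd j)))
      where
        p o : ℕ
        p = position ρ (partner j)
        o = position ρ (odd j)
        by-order : Before ρ (partner j) (odd j) ⊎ Before ρ (odd j) (partner j) → ∣ p - o ∣ ≤ 1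
        by-order (inj₁ p<o) = subst (λ v → ∣ p - v ∣ ≤ 1) (sym (pair-adjacent j (inj₁ (refl , refl)) p<o))
                                    (∣n-1+n∣≤1 p)
        by-order (inj₂ o<p) = subst (λ v → ∣ v - o ∣ ≤ 1) (sym (pair-adjacent j (inj₂ (refl , refl)) o<p))
                                    (subst (_≤ 1) (ℕ.∣-∣-comm o (suc o)) (∣n-1+n∣≤1 o))

    Order-odd-partner : ∀ j → Order (odd j) (partner j) ⇔ j ∈ A
    Order-odd-partner j = mk⇔ to′ from′
      where
        o~p : block (odd j) ≡ block (partner j)
        o~p = trans (block-odd j) (sym (block-partner j))
        to′ : Order (odd j) (partner j) → j ∈ A
        to′ (inj₁ (o≁p , _)) = contradiction o~p o≁p
        to′ (inj₂ (_ , inj₁ (o<p , _))) = contradiction o<p (<-asym (partner<odd j))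
        to′ (inj₂ (_ , inj₂ (_ , f))) = to (Flipped-pairBlock j) (subst Flipped (block-odd j) f)
        from′ : j ∈ A → Order (odd j) (partner j)
        from′ j∈A =
          inj₂ (o~p , inj₂ (partner<odd j , subst Flipped (sym (block-odd j)) (from (Flipped-pairBlock j) j∈A)))

    flips-ρ : flips ρ ≡ A
    flips-ρ = ⊆-antisym (λ {j} j∈ → to (Order-odd-partner j) (to Before-ρ (to (∈-flips ρ j) j∈)))
                        (λ {j} j∈A → from (∈-flips ρ j) (from Before-ρ (from (Order-odd-partner j) j∈A)))

    τ-ρ : τ ρ ≈ t
    τ-ρ = Before-⊆⇒≈ (τ ρ) t λ k l kl → by-order kl (to Before-ρ (to (Before-τ ρ) kl))
      where
        by-order : ∀ {k l} → Before (τ ρ) k l → Order (even k) (even l) → Before t k l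
        by-order {k} {l} _ (inj₁ (_ , kl)) = subst₂ (Before t) (block-even k) (block-even l) kl
        by-order {k} {l} kl (inj₂ (k~l , _)) =
          contradiction kl (<-irrefl (cong (τ ρ ⟨$⟩ˡ_) (trans (sym (block-even k)) (trans k~l (block-even l)))))

  Assemble-τ-flips : ∀ σ → PairsAdjacent σ → Assemble.ρ (τ σ) (flips σ) ≈ σ
  Assemble-τ-flips σ adj = Before-⊆⇒≈ ρ σ λ a b ab → by-order (to Before-ρ ab)
    where
      open Assemble (τ σ) (flips σ)
      in-pair : ∀ j {a b} → (a ≡ partner j × b ≡ odd j) ⊎ (a ≡ odd j × b ≡ partner j) → InBlock a b → Before σ a b
      in-pair j (inj₁ (refl , refl)) (inj₁ (_ , ¬f)) with Before-total σ (<⇒≢ (partner<odd j))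
      ... | inj₁ p<o = p<o
      ... | inj₂ o<p =
        contradiction (subst Flipped (sym (block-partner j)) (from (Flipped-pairBlock j) (from (∈-flips σ j) o<p))) ¬f
      in-pair j (inj₁ (refl , refl)) (inj₂ (o<p , _)) = contradiction o<p (<-asym (partner<odd j))
      in-pair j (inj₂ (refl , refl)) (inj₁ (o<p , _)) = contradiction o<p (<-asym (partner<odd j))
      in-pair j (inj₂ (refl , refl)) (inj₂ (_ , f)) =
        to (∈-flips σ j) (to (Flipped-pairBlock j) (subst Flipped (block-odd j) f))
      by-order : ∀ {a b} → Order a b → Before σ a b
      by-order (inj₁ (a≁b , ab)) = from (Before-blocks σ adj a≁b) (to (Before-τ σ) ab)
      by-order {a} {b} (inj₂ (a~b , ab)) =
        let (j , pair) = same-block a~b (λ { refl → InBlock-irreflexive a ab }) in in-pair j pair ab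

  even-mono-< : ∀ {k l} → k Fin.< l → even k Fin.< even l
  even-mono-< {k} {l} k<l = subst₂ _<_ (sym (toℕ-even k)) (sym (toℕ-even l)) (double-mono-< k<l)

  τ-mono : ∀ {u v} → u ⊆Inv v → τ u ⊆Inv τ v
  τ-mono {u} {v} u⊆v k l k<l lk = from (Before-τ v) (u⊆v (even k) (even l) (even-mono-< k<l) (to (Before-τ u) lk))

  flips-mono : ∀ {u v} → u ⊆Inv v → flips u ⊆ flips v
  flips-mono {u} {v} u⊆v {j} j∈ = from (∈-flips v j) (u⊆v (partner j) (odd j) (partner<odd j) (to (∈-flips u j) j∈))

  τ-flips-reflect : ∀ {u v} → PairsAdjacent u → PairsAdjacent v → τ u ⊆Inv τ v → flips u ⊆ flips v → u ⊆Inv v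
  τ-flips-reflect {u} {v} adj-u adj-v τu⊆τv fu⊆fv a b a<b ba with block a ≟ block b
  ... | no a≁b = from (Before-blocks v adj-v b≁a)
                   (to (Before-τ v) (τu⊆τv (block a) (block b) block-a<b
                     (from (Before-τ u) (to (Before-blocks u adj-u b≁a) ba))))
    where
      b≁a = λ b~a → a≁b (sym b~a)
      block-a<b : block a Fin.< block b
      block-a<b = ℕ.≤∧≢⇒< (subst₂ _≤_ (sym (toℕ-block a)) (sym (toℕ-block b)) (ℕ.⌊n/2⌋-mono (ℕ.<⇒≤ a<b)))
                          (λ eq → a≁b (toℕ-injective eq))
  ... | yes a~b with same-block a~b (<⇒≢ a<b)
  ...   | j , inj₁ (refl , refl) = to (∈-flips v j) (fu⊆fv (from (∈-flips u j) ba))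
  ...   | j , inj₂ (refl , refl) = contradiction a<b (<-asym (partner<odd j))

  toProd : W n → Prod c h
  toProd (σ , _) = τ σ , flips σ

  fromProd : Prod c h → W n
  fromProd (t , A) = Assemble.ρ t A , PairsAdjacent⇒IsWachs _ (Assemble.ρ-pairsAdjacent t A)

  toProd-mono : ∀ x y → x ≤W y → toProd x ≤P toProd y
  toProd-mono (u , _) (v , _) u≤v = ⊆Inv⇒≤R {u = τ u} {τ v} (τ-mono {u} {v} u⊆v) , flips-mono {u} {v} u⊆v
    where u⊆v = ≤R⇒⊆Inv {u = u} {v} u≤v

  toProd-reflect : ∀ x y → toProd x ≤P toProd y → x ≤W y
  toProd-reflect (u , u-wachs) (v , v-wachs) (τu≤τv , fu⊆fv) =
    ⊆Inv⇒≤R {u = u} {v} (τ-flips-reflect {u} {v} (IsWachs⇒PairsAdjacent u u-wachs) (IsWachs⇒PairsAdjacent v v-wachs)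
                                          (≤R⇒⊆Inv {u = τ u} {τ v} τu≤τv) fu⊆fv)

  toProd-fromProd≤ : ∀ b → toProd (fromProd b) ≤P b
  toProd-fromProd≤ (t , A) = ⊆Inv⇒≤R {u = τ ρ} {t} (≈⇒⊆Inv {u = τ ρ} {t} τ-ρ) , subst (λ S → _ ∈ S) flips-ρ
    where open Assemble t A

  ≤toProd-fromProd : ∀ b → b ≤P toProd (fromProd b)
  ≤toProd-fromProd (t , A) =
    ⊆Inv⇒≤R {u = t} {τ ρ} (≈⇒⊆Inv {u = t} {τ ρ} (λ k → sym (τ-ρ k))) , subst (λ S → _ ∈ S) (sym flips-ρ)
    where open Assemble t A

  wachs≅product : OrderIso {W n} {Prod c h} _≈W_ _≤W_ _≈P_ _≤P_
  wachs≅product = record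
    { to        = toProd
    ; from      = fromProd
    ; to-from   = λ (t , A) → Assemble.τ-ρ t A , Assemble.flips-ρ t A
    ; from-to   = λ (σ , σ-wachs) → Assemble-τ-flips σ (IsWachs⇒PairsAdjacent σ σ-wachs)
    ; monotone  = toProd-mono
    ; to-mono   = toProd-mono
    ; to-refl   = toProd-reflect
    ; from-mono = λ b b′ b≤b′ → toProd-reflect (fromProd b) (fromProd b′)
        (≤P-trans {x = toProd (fromProd b)} {b} {toProd (fromProd b′)} (toProd-fromProd≤ b)
          (≤P-trans {x = b} {b′} {toProd (fromProd b′)} b≤b′ (≤toProd-fromProd b′)))
    }

  wachs-complementedLattice : IsComplementedLattice (W n) _≤W_
  wachs-complementedLattice = IsComplementedLattice-retract toProd fromProd
    (λ {x} {y} → toProd-mono x y) (λ {x} {y} → toProd-reflect x y) toProd-fromProd≤ ≤toProd-fromProd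
    (λ {x} {y} {z} → ≤P-trans {x = x} {y} {z})
    (IsComplementedLattice-× (≤R-complementedLattice c) (Subset-complementedLattice h))

theorem5p3 : (n : ℕ) → 0 < n →
    OrderIso {W n} {Prod ⌈ n /2⌉ ⌊ n /2⌋} _≈W_ _≤W_ _≈P_ _≤P_
    × IsComplementedLattice (W n) _≤W_
theorem5p3 n _ = WachsIso.wachs≅product n , WachsIso.wachs-complementedLattice n
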